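{- Fix an integer $n\geq 2$. Let $p_k$ denote the $k$-th prime, $g(k)=p_{k+1}-p_k$, and $l_k=p_kp_{k+1}$. Then $$\varepsilon_2(n,l_k)\sim n^{\frac{3l_k}{\delta(l_k)}}\left(n^{ -3g(k)}+1\right)\quad\text{as } k\to\infty,$$ i.e. the ratio of the two sides tends to $1$.
   Context: $\Lambda(l)=\{d\ :\ d\mid l,\ d\not\equiv 0 \pmod 3,\ d\geq 4\}$ and $\delta(l)=\min\Lambda(l)$. A nonempty word $u$ is primitive if $u=v^m$ with $m$ a positive integer implies $m=1$; $|u|$ is its length. For an alphabet $\mathcal{A}$ of size $n$, $\varepsilon_2(n,l)$ is the number of pairs $(p,q)$ of primitive words over $\mathcal{A}$ with $|p|=2|q|=2l$, $pq$ not primitive, for which there exist nonempty words $\alpha,\beta$ and an integer $s\geq1$ with $\alpha\beta$ primitive, $q=(\alpha\beta)^{s}\alpha$, and either ($p=(\beta\alpha)^{2s}\beta$ and $|\beta|=2|\alpha|$) or ($p=(\beta\alpha)^{2s+1}\beta$ and $|\alpha|=2|\beta|$). -}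

module Defs where

open import Data.Nat as ℕ using (ℕ; zero; suc; _+_; _*_; _^_; _≤_)
open import Data.Nat.Properties using (m^n≢0)
open import Data.Nat.Divisibility using (_∣_)
open import Data.Nat.Primality using (Prime; prime?)
open import Data.Integer using (+_)
open import Data.Rational using (ℚ; _/_; _÷_; 0ℚ; 1ℚ; ≢-nonZero) renaming (_+_ to _+ℚ_; _*_ to _*ℚ_)
open import Data.Rational.Properties using () renaming (_≟_ to _≟ℚ_)
open import Data.Fin using (Fin)
open import Data.List using (List; []; _++_; length; filter; upTo)
open import Data.Product using (Σ; ∃; _×_; _,_)
open import Data.Sum using (_⊎_)
open import Relation.Nullary using (¬_; yes; no)
open import Relation.Binary.PropositionalEquality using (_≡_; _≢_)
open import Function.Definitions using (Injective)

pow : ∀ {A : Set} → List A → ℕ → List A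
pow v zero    = []
pow v (suc m) = v ++ pow v m

Primitive : ∀ {A : Set} → List A → Set
Primitive {A} u = u ≢ [] × ((v : List A) (m : ℕ) → 1 ≤ m → u ≡ pow v m → m ≡ 1)

Eps2Cond : (n l : ℕ) → List (Fin n) × List (Fin n) → Set
Eps2Cond n l (p , q) =
  Primitive p × Primitive q × length p ≡ 2 * l × length q ≡ l ×
  ¬ Primitive (p ++ q) ×
  Σ (List (Fin n)) λ α → Σ (List (Fin n)) λ β → Σ ℕ λ s →
    α ≢ [] × β ≢ [] × Primitive (α ++ β) × 1 ≤ s ×
    q ≡ pow (α ++ β) s ++ α ×
    ( (p ≡ pow (β ++ α) (2 * s) ++ β × length β ≡ 2 * length α)
    ⊎ (p ≡ pow (β ++ α) (suc (2 * s)) ++ β × length α ≡ 2 * length β))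

HasCount : ∀ {X : Set} → (X → Set) → ℕ → Set
HasCount {X} P N =
  Σ (Fin N → X) λ f → Injective _≡_ _≡_ f × ((i : Fin N) → P (f i)) ×
    ((x : X) → P x → ∃ λ i → f i ≡ x)

Eps2 : (n l N : ℕ) → Set
Eps2 n l N = HasCount (Eps2Cond n l) N

-- Primes:  p_k is the k-th prime (1-indexed, p_1 = 2)

primeCountBelow : ℕ → ℕ
primeCountBelow p = length (filter prime? (upTo p))

IsNthPrime : ℕ → ℕ → Set
IsNthPrime k p = Prime p × suc (primeCountBelow p) ≡ k

InΛ : ℕ → ℕ → Set
InΛ l d = d ∣ l × ¬ (3 ∣ d) × 4 ≤ d

IsDelta : ℕ → ℕ → Set
IsDelta l d = InΛ l d × ((d' : ℕ) → InΛ l d' → d ≤ d')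

-- n^(-k) as a rational (junk value 0 for n = 0)
invPow : ℕ → ℕ → ℚ
invPow zero k = 0ℚ
invPow n@(suc _) k = (+ 1) / (n ^ k) where instance _ = m^n≢0 n k

rhs : (n e g : ℕ) → ℚ
rhs n e g = ((+ (n ^ e)) / 1) *ℚ (invPow n (3 * g) +ℚ 1ℚ)

-- x / r  (junk value 0 when r = 0)
ratio : ℕ → ℚ → ℚ
ratio x r with r ≟ℚ 0ℚ
... | yes _ = 0ℚ
... | no r≢0 = ((+ x) / 1) ÷ r where instance _ = ≢-nonZero r≢0

-- For l = p P with primes 8 ≤ p < P, every pair counted by ε₂(n, l) arises by cutting w^m after 2l letters,
-- where w is a primitive word of length 3c and m c = l with m ≥ 2; conversely such a cut is counted as soon as
-- m ≥ 6 and 3 ∤ m, and by the Fine–Wilf theorem distinct words w give distinct pairs.  The cofactor pairs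
-- (c, m) are (P, p), (p, P) and (1, pP), so ε₂(n, pP) = π(3P) + π(3p) + π(3), where π(L) counts the primitive
-- words of length L.  Since n^L − (h + 1) n^(h+1) ≤ π(L) ≤ n^L whenever L ≤ 2h + 1, this is n^(3P) + n^(3p)
-- up to an error that is negligible against n^(3P) once P is large.  Finally δ(pP) = p, so the right-hand side
-- n^(3P) (n^(−3(P − p)) + 1) equals n^(3P) + n^(3p) as well.

module Submission where

module Primitivity where

  open import Data.Empty using (⊥-elim)
  open import Data.Fin using (Fin; toℕ; fromℕ<)
  open import Data.Fin.Properties using (any?; toℕ<n; toℕ-fromℕ<)
  open import Data.List using (List; []; _∷_; _++_; length; take; drop)
  open import Data.List.Properties
    using (length-++; ++-assoc; ++-identityʳ; take++drop≡id; length-drop; length-take; ++-conicalˡ; ++-conicalʳ; ≡-dec)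
  open import Data.Maybe using (Maybe; just; nothing)
  open import Data.Nat
  open import Data.Nat.Divisibility
  open import Data.Nat.Properties
  open import Data.Sum using (inj₁; inj₂)
  open import Data.Product using (Σ; ∃-syntax; _×_; _,_)
  open import Relation.Binary.Definitions using (DecidableEquality)
  open import Relation.Binary.PropositionalEquality
  open import Relation.Nullary using (Dec; yes; no; ¬_)
  open import Relation.Nullary.Decidable using (_×-dec_)
  open import Defs using (pow; Primitive)

  module _ {A : Set} where

    at : List A → ℕ → Maybe A
    at []       _       = nothing
    at (x ∷ xs) zero    = just x
    at (x ∷ xs) (suc i) = at xs i

    at-++ˡ : ∀ (xs ys : List A) {i} → i < length xs → at (xs ++ ys) i ≡ at xs i
    at-++ˡ (x ∷ xs) ys {zero}  _         = refl
    at-++ˡ (x ∷ xs) ys {suc i} (s≤s i<) = at-++ˡ xs ys i<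

    at-++ʳ : ∀ (xs ys : List A) i → at (xs ++ ys) (length xs + i) ≡ at ys i
    at-++ʳ []       ys i = refl
    at-++ʳ (x ∷ xs) ys i = at-++ʳ xs ys i

    at-take : ∀ j (u : List A) {i} → i < j → at (take j u) i ≡ at u i
    at-take (suc j) []      _         = refl
    at-take (suc j) (x ∷ u) {zero}  _         = refl
    at-take (suc j) (x ∷ u) {suc i} (s≤s i<j) = at-take j u i<j

    at-drop : ∀ j (u : List A) i → at (drop j u) i ≡ at u (j + i)
    at-drop zero    u       i = refl
    at-drop (suc j) []      i = refl
    at-drop (suc j) (x ∷ u) i = at-drop j u i

    at-injective : ∀ {xs ys : List A} → length xs ≡ length ys →
                   (∀ i → i < length xs → at xs i ≡ at ys i) → xs ≡ ys
    at-injective {[]}     {[]}     _  _  = refl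
    at-injective {x ∷ xs} {y ∷ ys} eq at≡ with at≡ 0 z<s
    ... | refl = cong (x ∷_) (at-injective (suc-injective eq) (λ i i< → at≡ (suc i) (s≤s i<)))

    length-take≤ : ∀ j (u : List A) → length (take j u) ≤ j
    length-take≤ j u = ≤-trans (≤-reflexive (length-take j u)) (m⊓n≤m j (length u))

    length-take≤length : ∀ j (u : List A) → length (take j u) ≤ length u
    length-take≤length j u = ≤-trans (≤-reflexive (length-take j u)) (m⊓n≤n j (length u))

    ≤length⇒length-take≡ : ∀ {j} (u : List A) → j ≤ length u → length (take j u) ≡ j
    ≤length⇒length-take≡ {j} u j≤ = trans (length-take j u) (m≤n⇒m⊓n≡m j≤)

    take-length-++ : ∀ (xs ys : List A) → take (length xs) (xs ++ ys) ≡ xs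
    take-length-++ []       ys = refl
    take-length-++ (x ∷ xs) ys = cong (x ∷_) (take-length-++ xs ys)

    drop-length-++ : ∀ (xs ys : List A) → drop (length xs) (xs ++ ys) ≡ ys
    drop-length-++ []       ys = refl
    drop-length-++ (x ∷ xs) ys = drop-length-++ xs ys

    take-length+-++ : ∀ (xs ys : List A) j → take (length xs + j) (xs ++ ys) ≡ xs ++ take j ys
    take-length+-++ []       ys j = refl
    take-length+-++ (x ∷ xs) ys j = cong (x ∷_) (take-length+-++ xs ys j)

    length≥1⇒≢[] : ∀ (w : List A) → 1 ≤ length w → w ≢ []
    length≥1⇒≢[] (x ∷ w) _ ()

    ≢[]⇒length≥1 : ∀ (w : List A) → w ≢ [] → 1 ≤ length w
    ≢[]⇒length≥1 []      w≢[] = ⊥-elim (w≢[] refl)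
    ≢[]⇒length≥1 (x ∷ w) _    = z<s

    pow-+ : ∀ (v : List A) a b → pow v (a + b) ≡ pow v a ++ pow v b
    pow-+ v zero    b = refl
    pow-+ v (suc a) b = trans (cong (v ++_) (pow-+ v a b)) (sym (++-assoc v (pow v a) (pow v b)))

    pow-sucʳ : ∀ (v : List A) m → pow v (suc m) ≡ pow v m ++ v
    pow-sucʳ v m = begin
      pow v (suc m)      ≡⟨ cong (pow v) (+-comm 1 m) ⟩
      pow v (m + 1)      ≡⟨ pow-+ v m 1 ⟩
      pow v m ++ v ++ [] ≡⟨ cong (pow v m ++_) (++-identityʳ v) ⟩
      pow v m ++ v       ∎
      where open ≡-Reasoning

    length-pow : ∀ (v : List A) m → length (pow v m) ≡ m * length v
    length-pow v zero    = refl
    length-pow v (suc m) = trans (length-++ v) (cong (length v +_) (length-pow v m))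

    take-length-pow++ : ∀ (w : List A) m x → 1 ≤ m → take (length w) (pow w m ++ x) ≡ w
    take-length-pow++ w (suc m) x _ = trans (cong (take (length w)) (++-assoc w (pow w m) x)) (take-length-++ w _)

    pow-nonprimitive : ∀ (x : List A) m → 2 ≤ m → ¬ Primitive (pow x m)
    pow-nonprimitive x m 2≤m (_ , prim) with prim x m (≤-trans (s≤s z≤n) 2≤m) refl
    ... | refl = <-irrefl refl 2≤m

    HasPeriod : List A → ℕ → Set
    HasPeriod u d = ∀ i → i + d < length u → at u i ≡ at u (i + d)

    HasPeriod-take : ∀ {u d} j → HasPeriod u d → HasPeriod (take j u) d
    HasPeriod-take {u} {d} j per i i+d< = begin
      at (take j u) i       ≡⟨ at-take j u (≤-<-trans (m≤m+n i d) i+d<j) ⟩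
      at u i                ≡⟨ per i (<-≤-trans i+d< (length-take≤length j u)) ⟩
      at u (i + d)          ≡⟨ at-take j u i+d<j ⟨
      at (take j u) (i + d) ∎
      where
        open ≡-Reasoning
        i+d<j : i + d < j
        i+d<j = <-≤-trans i+d< (length-take≤ j u)

    HasPeriod-tail : ∀ {x u d} → HasPeriod (x ∷ u) d → HasPeriod u d
    HasPeriod-tail per i i+d< = per (suc i) (s≤s i+d<)

    HasPeriod-drop : ∀ {u d} j → HasPeriod u d → HasPeriod (drop j u) d
    HasPeriod-drop         zero    per = per
    HasPeriod-drop {[]}    (suc j) per = λ _ ()
    HasPeriod-drop {x ∷ u} (suc j) per = HasPeriod-drop j (HasPeriod-tail per)

    pow-hasPeriod : ∀ (v : List A) m → HasPeriod (pow v m) (length v)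
    pow-hasPeriod v (suc m) i i+v< = begin
      at (pow v (suc m)) i            ≡⟨ cong (λ w → at w i) (pow-sucʳ v m) ⟩
      at (pow v m ++ v) i             ≡⟨ at-++ˡ (pow v m) v i< ⟩
      at (pow v m) i                  ≡⟨ at-++ʳ v (pow v m) i ⟨
      at (v ++ pow v m) (length v + i) ≡⟨ cong (at (v ++ pow v m)) (+-comm (length v) i) ⟩
      at (pow v (suc m)) (i + length v) ∎
      where
        open ≡-Reasoning
        i< : i < length (pow v m)
        i< = +-cancelˡ-< (length v) i _ (subst₂ _<_ (+-comm i (length v)) (length-++ v) i+v<)

    -- For i ≥ a the two periods are chained through i ∸ a, otherwise through i + d.
    HasPeriod-difference : ∀ {u} a d → HasPeriod u a → HasPeriod u (a + d) → a + (a + d) ≤ length u →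
                           HasPeriod u d
    HasPeriod-difference {u} a d perA perAD bound i i+d< with i + (a + d) <? length u
    ... | yes i+a+d< = begin
      at u i             ≡⟨ perAD i i+a+d< ⟩
      at u (i + (a + d)) ≡⟨ cong (at u) shuffle ⟨
      at u (i + d + a)   ≡⟨ perA (i + d) (subst (_< length u) (sym shuffle) i+a+d<) ⟨
      at u (i + d)       ∎
      where
        open ≡-Reasoning
        shuffle : i + d + a ≡ i + (a + d)
        shuffle = trans (+-assoc i d a) (cong (i +_) (+-comm d a))
    ... | no i+a+d≮ = begin
      at u i             ≡⟨ cong (at u) (m∸n+n≡m a≤i) ⟨
      at u (i ∸ a + a)   ≡⟨ perA (i ∸ a) (subst (_< length u) (sym (m∸n+n≡m a≤i)) (≤-<-trans (m≤m+n i d) i+d<)) ⟨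
      at u (i ∸ a)       ≡⟨ perAD (i ∸ a) (subst (_< length u) (sym reassoc) i+d<) ⟩
      at u (i ∸ a + (a + d)) ≡⟨ cong (at u) reassoc ⟩
      at u (i + d)       ∎
      where
        open ≡-Reasoning
        a≤i : a ≤ i
        a≤i = +-cancelʳ-≤ (a + d) a i (≤-trans bound (≮⇒≥ i+a+d≮))
        reassoc : i ∸ a + (a + d) ≡ i + d
        reassoc = trans (sym (+-assoc (i ∸ a) a d)) (cong (_+ d) (m∸n+n≡m a≤i))

    CommonPeriod : List A → ℕ → ℕ → Set
    CommonPeriod u a b = ∃[ g ] (1 ≤ g × g ∣ a × g ∣ b × HasPeriod u g)

    private
      -- Euclid's algorithm on periods; the fuel bounds a + b.
      commonPeriod′ : ∀ fuel {u} a b → a + b ≤ fuel → 1 ≤ a → HasPeriod u a → HasPeriod u b →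
                      a + b ≤ length u → CommonPeriod u a b
      commonPeriod′ fuel    a zero    _  1≤a perA _    _ = a , 1≤a , ∣-refl , (a ∣0) , perA
      commonPeriod′ zero    (suc a) (suc b) () _ _ _ _
      commonPeriod′ (suc fuel) {u} a b@(suc _) a+b≤ 1≤a perA perB a+b≤u with ≤-total a b
      ... | inj₁ a≤b =
        let d , a+d≡b = m≤n⇒∃[o]m+o≡n a≤b
            a+b≤u′    = subst (λ x → a + x ≤ length u) (sym a+d≡b) a+b≤u
            g , 1≤g , g∣a , g∣d , perG =
              commonPeriod′ fuel {u} a d (subst (_≤ fuel) (sym a+d≡b) (s≤s⁻¹ (<-≤-trans (m<n+m b 1≤a) a+b≤)))
                1≤a perA (HasPeriod-difference {u} a d perA (subst (HasPeriod u) (sym a+d≡b) perB) a+b≤u′)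
                (≤-trans (+-monoʳ-≤ a (m≤n+m d a)) a+b≤u′)
        in g , 1≤g , g∣a , subst (g ∣_) a+d≡b (∣m∣n⇒∣m+n g∣a g∣d) , perG
      ... | inj₂ b≤a =
        let d , b+d≡a = m≤n⇒∃[o]m+o≡n b≤a
            b+a≤u     = subst (_≤ length u) (+-comm a b) a+b≤u
            b+a≤u′    = subst (λ x → b + x ≤ length u) (sym b+d≡a) b+a≤u
            g , 1≤g , g∣b , g∣d , perG =
              commonPeriod′ fuel {u} b d (subst (_≤ fuel) (sym b+d≡a) (s≤s⁻¹ (<-≤-trans (m<m+n a z<s) a+b≤)))
                z<s perB (HasPeriod-difference {u} b d perB (subst (HasPeriod u) (sym b+d≡a) perA) b+a≤u′)
                (≤-trans (+-monoʳ-≤ b (m≤n+m d b)) b+a≤u′)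
        in g , 1≤g , subst (g ∣_) b+d≡a (∣m∣n⇒∣m+n g∣b g∣d) , g∣b , perG

    commonPeriod : ∀ {u a b} → 1 ≤ a → HasPeriod u a → HasPeriod u b → a + b ≤ length u → CommonPeriod u a b
    commonPeriod {u} {a} {b} = commonPeriod′ (a + b) {u} a b ≤-refl

    take-drop-periodic : ∀ {g} (w : List A) → HasPeriod w g → g + g ≤ length w → take g (drop g w) ≡ take g w
    take-drop-periodic {g} w per g+g≤ = at-injective
      (trans (≤length⇒length-take≡ (drop g w) (subst (g ≤_) (sym (length-drop g w)) (m+n≤o⇒m≤o∸n g g+g≤)))
             (sym (≤length⇒length-take≡ w (m+n≤o⇒m≤o g g+g≤))))
      λ i i< → let i<g = <-≤-trans i< (length-take≤ g (drop g w)) in begin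
        at (take g (drop g w)) i ≡⟨ at-take g (drop g w) i<g ⟩
        at (drop g w) i          ≡⟨ at-drop g w i ⟩
        at w (g + i)             ≡⟨ cong (at w) (+-comm g i) ⟩
        at w (i + g)             ≡⟨ per i (<-≤-trans (+-monoˡ-< g i<g) g+g≤) ⟨
        at w i                   ≡⟨ at-take g w i<g ⟨
        at (take g w) i          ∎
      where open ≡-Reasoning

    periodic⇒pow : ∀ {g} (w : List A) k → HasPeriod w g → length w ≡ k * g → w ≡ pow (take g w) k
    periodic⇒pow []      zero    _   _  = refl
    periodic⇒pow {g} w (suc k) per |w| = begin
      w                                     ≡⟨ take++drop≡id g w ⟨
      take g w ++ drop g w                  ≡⟨ cong (take g w ++_) (periodic⇒pow (drop g w) k (HasPeriod-drop g per) |drop|) ⟩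
      take g w ++ pow (take g (drop g w)) k ≡⟨ cong (take g w ++_) (shift k refl) ⟩
      take g w ++ pow (take g w) k          ∎
      where
        open ≡-Reasoning
        |drop| : length (drop g w) ≡ k * g
        |drop| = trans (length-drop g w) (trans (cong (_∸ g) |w|) (m+n∸m≡n g (k * g)))
        shift : ∀ k′ → k′ ≡ k → pow (take g (drop g w)) k′ ≡ pow (take g w) k′
        shift zero     _    = refl
        shift (suc k′) refl = cong (λ v → pow v (suc k′)) (take-drop-periodic w per
          (subst (g + g ≤_) (sym |w|) (+-monoʳ-≤ g (m≤m+n g (k′ * g)))))

    primitive-period : ∀ {g} (w : List A) → Primitive w → HasPeriod w g → g ∣ length w → g ≡ length w
    primitive-period w (w≢[] , _) per (divides zero |w|) = ⊥-elim (w≢[] (length≡0⇒≡[] w |w|))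
      where
        length≡0⇒≡[] : ∀ (w : List A) → length w ≡ 0 → w ≡ []
        length≡0⇒≡[] [] _ = refl
    primitive-period {g} w (_ , prim) per (divides (suc k) |w|)
      with prim (take g w) (suc k) z<s (periodic⇒pow w (suc k) per |w|)
    ... | refl = trans (sym (+-identityʳ g)) (sym |w|)

    -- α ++ β is a factor of (β ++ α)², so β ++ α = v^m makes α ++ β periodic with period |v|, hence an m-th power.
    primitive-rotate : ∀ (α β : List A) → Primitive (α ++ β) → Primitive (β ++ α)
    primitive-rotate α β (αβ≢[] , prim) = βα≢[] , prim′
      where
        βα≢[] : β ++ α ≢ []
        βα≢[] βα≡[] = αβ≢[] (cong₂ _++_ (++-conicalʳ β α βα≡[]) (++-conicalˡ β α βα≡[]))
        prim′ : ∀ v m → 1 ≤ m → β ++ α ≡ pow v m → m ≡ 1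
        prim′ v m 1≤m βα≡ = prim (take (length v) (α ++ β)) m 1≤m (periodic⇒pow (α ++ β) m perαβ |αβ|)
          where
            square : (β ++ α) ++ (β ++ α) ≡ β ++ ((α ++ β) ++ α)
            square = trans (++-assoc β α (β ++ α)) (cong (β ++_) (sym (++-assoc α β α)))
            factor : α ++ β ≡ take (length (α ++ β)) (drop (length β) ((β ++ α) ++ (β ++ α)))
            factor = sym (begin
              take (length (α ++ β)) (drop (length β) ((β ++ α) ++ (β ++ α)))
                ≡⟨ cong (λ z → take (length (α ++ β)) (drop (length β) z)) square ⟩
              take (length (α ++ β)) (drop (length β) (β ++ ((α ++ β) ++ α)))
                ≡⟨ cong (take (length (α ++ β))) (drop-length-++ β _) ⟩
              take (length (α ++ β)) ((α ++ β) ++ α)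
                ≡⟨ take-length-++ (α ++ β) α ⟩
              α ++ β ∎)
              where open ≡-Reasoning
            perSquare : HasPeriod ((β ++ α) ++ (β ++ α)) (length v)
            perSquare = subst (λ z → HasPeriod z (length v))
              (sym (trans (cong₂ _++_ βα≡ βα≡) (sym (pow-+ v m m)))) (pow-hasPeriod v (m + m))
            perαβ : HasPeriod (α ++ β) (length v)
            perαβ = subst (λ z → HasPeriod z (length v)) (sym factor)
              (HasPeriod-take (length (α ++ β)) (HasPeriod-drop (length β) perSquare))
            |αβ| : length (α ++ β) ≡ m * length v
            |αβ| = begin
              length (α ++ β)         ≡⟨ length-++ α ⟩
              length α + length β     ≡⟨ +-comm (length α) (length β) ⟩
              length β + length α     ≡⟨ length-++ β ⟨
              length (β ++ α)         ≡⟨ cong length βα≡ ⟩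
              length (pow v m)        ≡⟨ length-pow v m ⟩
              m * length v            ∎
              where open ≡-Reasoning

    -- A second period of u whose length is a multiple ≥ 2 would combine with L into a period
    -- of the primitive prefix that divides L, forcing L ∣ |u|.
    primitive-extension : ∀ L (u : List A) → 1 ≤ L → Primitive (take L u) → HasPeriod u L →
                          2 * L ≤ length u → ¬ (L ∣ length u) → Primitive u
    primitive-extension L u 1≤L primPrefix perL 2L≤u L∤u =
      length≥1⇒≢[] u (≤-trans 1≤L (m+n≤o⇒m≤o L 2L≤u)) , prim
      where
        |prefix| : length (take L u) ≡ L
        |prefix| = ≤length⇒length-take≡ u (m+n≤o⇒m≤o L 2L≤u)
        prim : ∀ v m → 1 ≤ m → u ≡ pow v m → m ≡ 1
        prim v (suc zero)     _ _    = refl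
        prim v (suc (suc m)) _ u≡vᵐ = ⊥-elim (L∤u (∣-trans L∣v (divides (suc (suc m)) |u|)))
          where
            |u| : length u ≡ suc (suc m) * length v
            |u| = trans (cong length u≡vᵐ) (length-pow v (suc (suc m)))
            perV : HasPeriod u (length v)
            perV = subst (λ z → HasPeriod z (length v)) (sym u≡vᵐ) (pow-hasPeriod v (suc (suc m)))
            2v≤u : 2 * length v ≤ length u
            2v≤u = subst (2 * length v ≤_) (sym |u|) (*-monoˡ-≤ (length v) (s≤s (s≤s (z≤n {m}))))
            L+v≤u : L + length v ≤ length u
            L+v≤u with ≤-total L (length v)
            ... | inj₁ L≤v = ≤-trans (+-monoˡ-≤ (length v) L≤v) (subst (_≤ length u) (cong (length v +_) (+-identityʳ _)) 2v≤u)
            ... | inj₂ v≤L = ≤-trans (+-monoʳ-≤ L v≤L) (subst (_≤ length u) (cong (L +_) (+-identityʳ L)) 2L≤u)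
            L∣v : L ∣ length v
            L∣v with commonPeriod {u} 1≤L perL perV L+v≤u
            ... | g , _ , g∣L , g∣v , perG = subst (_∣ length v) g≡L g∣v
              where
                g≡L : g ≡ L
                g≡L = trans (primitive-period (take L u) primPrefix (HasPeriod-take L perG)
                               (subst (g ∣_) (sym |prefix|) g∣L))
                            |prefix|

    pow-[] : ∀ m → pow ([] {A = A}) m ≡ []
    pow-[] zero    = refl
    pow-[] (suc m) = pow-[] m

  private
    cofactor≥2 : ∀ {k d L} → d < L → L ≡ k * d → 2 ≤ k
    cofactor≥2 {zero}        d<L refl = ⊥-elim (<⇒≱ d<L z≤n)
    cofactor≥2 {suc zero}    d<L L≡  = ⊥-elim (<-irrefl (sym (trans L≡ (+-identityʳ _))) d<L)
    cofactor≥2 {suc (suc k)} _   _   = s≤s (s≤s z≤n)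

  module _ {A : Set} (_≟_ : DecidableEquality A) where

    -- d is the length of a proper root of u, detected as invariance of u under a shift by d.
    IsRootLength : List A → ℕ → Set
    IsRootLength u d = 1 ≤ d × d ∣ length u × drop d u ≡ take (length u ∸ d) u

    isRootLength? : ∀ u d → Dec (IsRootLength u d)
    isRootLength? u d = (1 ≤? d) ×-dec (d ∣? length u) ×-dec ≡-dec _≟_ (drop d u) (take (length u ∸ d) u)

    shift-invariant⇒period : ∀ (u : List A) d → drop d u ≡ take (length u ∸ d) u → HasPeriod u d
    shift-invariant⇒period u d shift i i+d< = begin
      at u i                      ≡⟨ at-take (length u ∸ d) u (m+n≤o⇒m≤o∸n (suc i) i+d<) ⟨
      at (take (length u ∸ d) u) i ≡⟨ cong (λ w → at w i) shift ⟨
      at (drop d u) i             ≡⟨ at-drop d u i ⟩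
      at u (d + i)                ≡⟨ cong (at u) (+-comm d i) ⟩
      at u (i + d)                ∎
      where open ≡-Reasoning

    rootLength⇒pow : ∀ (u : List A) (i : Fin (length u)) → IsRootLength u (toℕ i) →
                     ∃[ k ] (2 ≤ k × u ≡ pow (take (toℕ i) u) k)
    rootLength⇒pow u i (_ , divides k |u| , shift) =
      k , cofactor≥2 (toℕ<n i) |u| , periodic⇒pow u k (shift-invariant⇒period u (toℕ i) shift) |u|

    pow⇒rootLength : ∀ (u v : List A) m → u ≢ [] → u ≡ pow v (2 + m) →
                     Σ (Fin (length u)) λ i → IsRootLength u (toℕ i)
    pow⇒rootLength u v m u≢[] u≡vᵐ =
      fromℕ< |v|<|u| , subst (IsRootLength u) (sym (toℕ-fromℕ< |v|<|u|)) (1≤|v| , |v|∣|u| , shift)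
      where
        rest : List A
        rest = pow v (suc m)
        |u| : length u ≡ length v + length rest
        |u| = trans (cong length u≡vᵐ) (length-++ v)
        1≤|v| : 1 ≤ length v
        1≤|v| = ≢[]⇒length≥1 v (λ v≡[] → u≢[] (trans u≡vᵐ (trans (cong (λ z → pow z (2 + m)) v≡[]) (pow-[] (2 + m)))))
        |v|<|u| : length v < length u
        |v|<|u| = subst (length v <_) (sym |u|)
          (m<m+n (length v) (≤-trans 1≤|v| (subst (length v ≤_) (sym (length-++ v)) (m≤m+n (length v) _))))
        |v|∣|u| : length v ∣ length u
        |v|∣|u| = divides (2 + m) (trans (cong length u≡vᵐ) (length-pow v (2 + m)))
        shift : drop (length v) u ≡ take (length u ∸ length v) u
        shift = begin
          drop (length v) u                        ≡⟨ cong (drop (length v)) u≡vᵐ ⟩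
          drop (length v) (v ++ rest)              ≡⟨ drop-length-++ v rest ⟩
          rest                                     ≡⟨ take-length-++ rest v ⟨
          take (length rest) (rest ++ v)           ≡⟨ cong (take (length rest)) (pow-sucʳ v (suc m)) ⟨
          take (length rest) u′                    ≡⟨ cong₂ take (sym (trans (cong (_∸ length v) |u|) (m+n∸m≡n (length v) _)))
                                                                (sym u≡vᵐ) ⟩
          take (length u ∸ length v) u             ∎
          where
            open ≡-Reasoning
            u′ : List A
            u′ = pow v (2 + m)

    noRootLength⇒primitive : ∀ (u : List A) → u ≢ [] →
                             ¬ (Σ (Fin (length u)) λ i → IsRootLength u (toℕ i)) → Primitive u
    noRootLength⇒primitive u u≢[] noRoot = u≢[] , prim
      where
        prim : ∀ v m → 1 ≤ m → u ≡ pow v m → m ≡ 1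
        prim v (suc zero)    _ _     = refl
        prim v (suc (suc m)) _ u≡vᵐ = ⊥-elim (noRoot (pow⇒rootLength u v m u≢[] u≡vᵐ))

    primitive? : ∀ (u : List A) → Dec (Primitive u)
    primitive? []          = no λ (u≢[] , _) → u≢[] refl
    primitive? u@(_ ∷ _) with any? (λ i → isRootLength? u (toℕ i))
    ... | yes (i , root) = no λ prim → let k , 2≤k , u≡ = rootLength⇒pow u i root in
                             pow-nonprimitive _ k 2≤k (subst Primitive u≡ prim)
    ... | no noRoot      = yes (noRootLength⇒primitive u (λ ()) noRoot)

    nonprimitive⇒pow : ∀ (u : List A) → u ≢ [] → ¬ Primitive u → ∃[ v ] ∃[ k ] (2 ≤ k × u ≡ pow v k)
    nonprimitive⇒pow u u≢[] nonprim with any? (λ i → isRootLength? u (toℕ i))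
    ... | yes (i , root) = take (toℕ i) u , rootLength⇒pow u i root
    ... | no noRoot      = ⊥-elim (nonprim (noRootLength⇒primitive u u≢[] noRoot))

module Counting where

  open import Data.Empty using (⊥-elim)
  open import Data.Fin using (Fin)
  open import Data.Fin.Properties using () renaming (_≟_ to _≟ᶠ_)
  open import Data.List using (List; []; _∷_; _++_; length; take; map; filter; lookup; allFin; cartesianProductWith)
  open import Data.List.Properties using (length-++; length-map; length-filter; length-tabulate; ∷-injective)
  open import Data.List.Membership.Propositional using (_∈_)
  open import Data.List.Membership.Propositional.Properties
    using (∈-map⁺; ∈-map⁻; ∈-++⁺ˡ; ∈-++⁺ʳ; ∈-++⁻; ∈-filter⁺; ∈-filter⁻; ∈-allFin; ∈-lookup;
           ∈-cartesianProductWith⁺; ∈-cartesianProductWith⁻)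
  open import Data.List.Relation.Unary.All as All using (All; []; _∷_)
  open import Data.List.Relation.Unary.AllPairs using ([]; _∷_)
  open import Data.List.Relation.Unary.Any as Any using (here; there)
  open import Data.List.Relation.Unary.Any.Properties using (lookup-index)
  open import Data.List.Relation.Unary.Unique.Propositional using (Unique)
  open import Data.List.Relation.Binary.Disjoint.Propositional using (Disjoint)
  open import Data.List.Relation.Unary.Unique.Propositional.Properties using (filter⁺; allFin⁺; cartesianProductWith⁺)
  open import Data.Nat
  open import Data.Nat.Properties
  open import Data.Sum using (inj₁; inj₂)
  open import Data.Product using (_×_; _,_)
  open import Function.Definitions using (Injective)
  open import Relation.Binary.PropositionalEquality
  open import Relation.Nullary using (¬_; yes; no)
  open import Relation.Unary using (Decidable)
  open import Relation.Unary.Properties using (∁?)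
  open import Defs using (pow; Primitive; HasCount)
  open Primitivity

  module _ {A : Set} where

    private
      remove : ∀ {x : A} (ys : List A) → x ∈ ys → List A
      remove (y ∷ ys) (here _)    = ys
      remove (y ∷ ys) (there x∈) = y ∷ remove ys x∈

      length-remove : ∀ {x : A} (ys : List A) (x∈ : x ∈ ys) → length ys ≡ suc (length (remove ys x∈))
      length-remove (y ∷ ys) (here _)    = refl
      length-remove (y ∷ ys) (there x∈) = cong suc (length-remove ys x∈)

      ∈-remove : ∀ {x z : A} (ys : List A) (x∈ : x ∈ ys) → z ∈ ys → z ≢ x → z ∈ remove ys x∈
      ∈-remove (y ∷ ys) (here refl) (here refl) z≢x = ⊥-elim (z≢x refl)
      ∈-remove (y ∷ ys) (here refl) (there z∈) _   = z∈
      ∈-remove (y ∷ ys) (there x∈) (here z≡y) _    = here z≡y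
      ∈-remove (y ∷ ys) (there x∈) (there z∈) z≢x = there (∈-remove ys x∈ z∈ z≢x)

    Unique-⊆⇒length≤ : ∀ {xs ys : List A} → Unique xs → (∀ {z} → z ∈ xs → z ∈ ys) → length xs ≤ length ys
    Unique-⊆⇒length≤ {[]}     _          _  = z≤n
    Unique-⊆⇒length≤ {x ∷ xs} {ys} (x∉ ∷ u) xs⊆ = subst (suc (length xs) ≤_) (sym (length-remove ys x∈))
      (s≤s (Unique-⊆⇒length≤ u λ z∈ → ∈-remove ys x∈ (xs⊆ (there z∈)) λ z≡x → All.lookup x∉ z∈ (sym z≡x)))
      where
        x∈ : x ∈ ys
        x∈ = xs⊆ (here refl)

    lookup-injective : ∀ {xs : List A} → Unique xs → Injective _≡_ _≡_ (lookup xs)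
    lookup-injective {x ∷ xs} _         {Fin.zero}  {Fin.zero}  _ = refl
    lookup-injective {x ∷ xs} (x∉ ∷ _) {Fin.zero}  {Fin.suc j} e = ⊥-elim (All.lookup x∉ (∈-lookup j) e)
    lookup-injective {x ∷ xs} (x∉ ∷ _) {Fin.suc i} {Fin.zero}  e = ⊥-elim (All.lookup x∉ (∈-lookup i) (sym e))
    lookup-injective {x ∷ xs} (_ ∷ u)  {Fin.suc i} {Fin.suc j} e = cong Fin.suc (lookup-injective u e)

    Unique⇒HasCount : ∀ {P : A → Set} {xs : List A} → Unique xs → (∀ {x} → x ∈ xs → P x) →
                      (∀ x → P x → x ∈ xs) → HasCount P (length xs)
    Unique⇒HasCount {xs = xs} u sound complete =
      lookup xs , lookup-injective u , (λ i → sound (∈-lookup i)) ,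
      λ x px → let x∈ = complete x px in Any.index x∈ , sym (lookup-index x∈)

    length-filter+length-filter-∁ : ∀ {P : A → Set} (P? : Decidable P) (xs : List A) →
                                    length (filter P? xs) + length (filter (∁? P?) xs) ≡ length xs
    length-filter+length-filter-∁ P? []       = refl
    length-filter+length-filter-∁ P? (x ∷ xs) with P? x
    ... | yes _ = cong suc (length-filter+length-filter-∁ P? xs)
    ... | no  _ = trans (+-suc _ _) (cong suc (length-filter+length-filter-∁ P? xs))

    Disjoint-++ʳ : ∀ {xs ys zs : List A} → Disjoint xs ys → Disjoint xs zs → Disjoint xs (ys ++ zs)
    Disjoint-++ʳ {ys = ys} xs#ys xs#zs (v∈xs , v∈ys++zs) with ∈-++⁻ ys v∈ys++zs
    ... | inj₁ v∈ys = xs#ys (v∈xs , v∈ys)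
    ... | inj₂ v∈zs = xs#zs (v∈xs , v∈zs)

  module _ {A B C : Set} (f : A → B → C) where

    length-cartesianProductWith : ∀ xs ys → length (cartesianProductWith f xs ys) ≡ length xs * length ys
    length-cartesianProductWith []       ys = refl
    length-cartesianProductWith (x ∷ xs) ys =
      trans (length-++ (map (f x) ys)) (cong₂ _+_ (length-map (f x) ys) (length-cartesianProductWith xs ys))

  module _ {A B : Set} where

    Unique-map⁺ : ∀ (f : A → B) {xs : List A} → Unique xs →
                  (∀ {x y} → x ∈ xs → y ∈ xs → f x ≡ f y → x ≡ y) → Unique (map f xs)
    Unique-map⁺ f {[]}     []        _   = []
    Unique-map⁺ f {x ∷ xs} (x∉ ∷ u) inj =
      All.tabulate (λ {fy} fy∈ → fx≢ fy∈) ∷ Unique-map⁺ f u (λ x∈ y∈ → inj (there x∈) (there y∈))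
      where
        fx≢ : ∀ {fy} → fy ∈ map f xs → f x ≢ fy
        fx≢ {fy} fy∈ fx≡fy with ∈-map⁻ f fy∈
        ... | y , y∈ , refl = All.lookup x∉ y∈ (inj (here refl) (there y∈) fx≡fy)

  module Enumeration (n : ℕ) where

    Word : Set
    Word = List (Fin n)

    words : ℕ → List Word
    words zero    = [] ∷ []
    words (suc m) = cartesianProductWith _∷_ (allFin n) (words m)

    length-words : ∀ m → length (words m) ≡ n ^ m
    length-words zero    = refl
    length-words (suc m) = trans (length-cartesianProductWith _∷_ (allFin n) (words m))
                                 (cong₂ _*_ (length-tabulate {n = n} (λ i → i)) (length-words m))

    words-unique : ∀ m → Unique (words m)
    words-unique zero    = [] ∷ []
    words-unique (suc m) = cartesianProductWith⁺ _∷_ ∷-injective (allFin⁺ n) (words-unique m)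

    ∈-words : ∀ (w : Word) → w ∈ words (length w)
    ∈-words []      = here refl
    ∈-words (x ∷ w) = ∈-cartesianProductWith⁺ _∷_ (∈-allFin x) (∈-words w)

    ∈-words⇒length : ∀ m {w} → w ∈ words m → length w ≡ m
    ∈-words⇒length zero    (here refl) = refl
    ∈-words⇒length (suc m) w∈ with ∈-cartesianProductWith⁻ _∷_ (allFin n) (words m) w∈
    ... | x , v , _ , v∈ , refl = cong suc (∈-words⇒length m v∈)

    primitiveWords : ℕ → List Word
    primitiveWords L = filter (primitive? _≟ᶠ_) (words L)

    primitiveWords-unique : ∀ L → Unique (primitiveWords L)
    primitiveWords-unique L = filter⁺ (primitive? _≟ᶠ_) (words-unique L)

    ∈-primitiveWords⁺ : ∀ {L} (w : Word) → length w ≡ L → Primitive w → w ∈ primitiveWords L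
    ∈-primitiveWords⁺ w refl prim = ∈-filter⁺ (primitive? _≟ᶠ_) (∈-words w) prim

    ∈-primitiveWords⁻ : ∀ L {w} → w ∈ primitiveWords L → length w ≡ L × Primitive w
    ∈-primitiveWords⁻ L w∈ = let w∈words , prim = ∈-filter⁻ (primitive? _≟ᶠ_) w∈ in
      ∈-words⇒length L w∈words , prim

    length-primitiveWords≤ : ∀ L → length (primitiveWords L) ≤ n ^ L
    length-primitiveWords≤ L = subst (length (primitiveWords L) ≤_) (length-words L) (length-filter _ (words L))

    periodicWords : ℕ → ℕ → List Word
    periodicWords L zero    = []
    periodicWords L (suc D) = map (λ v → take L (pow v L)) (words D) ++ periodicWords L D

    length-periodicWords : 1 ≤ n → ∀ L D → length (periodicWords L D) ≤ D * n ^ D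
    length-periodicWords 1≤n L zero    = z≤n
    length-periodicWords 1≤n L (suc D) = begin
      length (map (λ v → take L (pow v L)) (words D) ++ periodicWords L D)
        ≡⟨ length-++ (map (λ v → take L (pow v L)) (words D)) ⟩
      length (map (λ v → take L (pow v L)) (words D)) + length (periodicWords L D)
        ≡⟨ cong (_+ length (periodicWords L D)) (trans (length-map _ (words D)) (length-words D)) ⟩
      n ^ D + length (periodicWords L D) ≤⟨ +-monoʳ-≤ (n ^ D) (length-periodicWords 1≤n L D) ⟩
      n ^ D + D * n ^ D                  ≤⟨ *-monoʳ-≤ (suc D) (subst (_≤ n ^ suc D) (*-identityˡ (n ^ D)) (*-monoˡ-≤ (n ^ D) 1≤n)) ⟩
      suc D * n ^ suc D                  ∎
      where open ≤-Reasoning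

    ∈-periodicWords : ∀ L {D} (v : Word) → length v < D → take L (pow v L) ∈ periodicWords L D
    ∈-periodicWords L {suc D} v v<D with m<1+n⇒m<n∨m≡n v<D
    ... | inj₁ v<D′ = ∈-++⁺ʳ _ (∈-periodicWords L v v<D′)
    ... | inj₂ refl = ∈-++⁺ˡ (∈-map⁺ (λ v → take L (pow v L)) (∈-words v))

    take-pow : ∀ (v : Word) k L → k * length v ≡ L → k ≤ L → take L (pow v L) ≡ pow v k
    take-pow v k L k|v|≡L k≤L = begin
      take L (pow v L)                     ≡⟨ cong (λ m → take L (pow v m)) (m+[n∸m]≡n k≤L) ⟨
      take L (pow v (k + (L ∸ k)))          ≡⟨ cong (take L) (pow-+ v k (L ∸ k)) ⟩
      take L (pow v k ++ pow v (L ∸ k))     ≡⟨ cong (λ m → take m (pow v k ++ pow v (L ∸ k))) (trans (length-pow v k) k|v|≡L) ⟨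
      take (length (pow v k)) (pow v k ++ pow v (L ∸ k)) ≡⟨ take-length-++ (pow v k) _ ⟩
      pow v k                               ∎
      where open ≡-Reasoning

    -- A nonprimitive word is a power v^k with k ≥ 2, hence generated by its root of length ≤ L / 2.
    nonprimitive∈periodicWords : ∀ L h (u : Word) → 1 ≤ L → L ≤ 2 * h + 1 → u ∈ words L → ¬ Primitive u →
                                 u ∈ periodicWords L (suc h)
    nonprimitive∈periodicWords L h u 1≤L L≤ u∈ nonprim
      with nonprimitive⇒pow _≟ᶠ_ u (length≥1⇒≢[] u (subst (1 ≤_) (sym |u|) 1≤L)) nonprim
      where
        |u| : length u ≡ L
        |u| = ∈-words⇒length L u∈
    ... | v , k , 2≤k , u≡vᵏ = subst (_∈ periodicWords L (suc h)) (sym u≡) (∈-periodicWords L v |v|<1+h)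
      where
        open ≤-Reasoning
        k|v|≡L : k * length v ≡ L
        k|v|≡L = trans (sym (length-pow v k)) (trans (cong length (sym u≡vᵏ)) (∈-words⇒length L u∈))
        1≤|v| : 1 ≤ length v
        1≤|v| with length v | k|v|≡L
        ... | zero  | k0≡L = ⊥-elim (<⇒≱ 1≤L (≤-reflexive (trans (sym k0≡L) (*-zeroʳ k))))
        ... | suc _ | _    = s≤s z≤n
        |v|<1+h : length v < suc h
        |v|<1+h = *-cancelˡ-< 2 (length v) (suc h) (begin-strict
          2 * length v ≤⟨ *-monoˡ-≤ (length v) 2≤k ⟩
          k * length v ≡⟨ k|v|≡L ⟩
          L            ≤⟨ L≤ ⟩
          2 * h + 1    <⟨ +-monoʳ-< (2 * h) (s≤s (s≤s z≤n)) ⟩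
          2 * h + 2    ≡⟨ trans (*-suc 2 h) (+-comm 2 (2 * h)) ⟨
          2 * suc h    ∎)
        u≡ : u ≡ take L (pow v L)
        u≡ = trans u≡vᵏ (sym (take-pow v k L k|v|≡L (subst (k ≤_) k|v|≡L (m≤m*n k (length v)))))
          where instance _ = >-nonZero 1≤|v|

    length-primitiveWords≥ : 1 ≤ n → ∀ L h → 1 ≤ L → L ≤ 2 * h + 1 →
                             n ^ L ≤ length (primitiveWords L) + suc h * n ^ suc h
    length-primitiveWords≥ 1≤n L h 1≤L L≤ = begin
      n ^ L                                                  ≡⟨ length-words L ⟨
      length (words L)                                       ≡⟨ length-filter+length-filter-∁ (primitive? _≟ᶠ_) (words L) ⟨
      length (primitiveWords L) + length nonprimitiveWords   ≤⟨ +-monoʳ-≤ (length (primitiveWords L)) nonprimitive≤ ⟩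
      length (primitiveWords L) + suc h * n ^ suc h          ∎
      where
        open ≤-Reasoning
        nonprimitiveWords : List Word
        nonprimitiveWords = filter (∁? (primitive? _≟ᶠ_)) (words L)
        nonprimitive≤ : length nonprimitiveWords ≤ suc h * n ^ suc h
        nonprimitive≤ = ≤-trans
          (Unique-⊆⇒length≤ (filter⁺ (∁? (primitive? _≟ᶠ_)) (words-unique L))
            λ u∈ → let u∈words , nonprim = ∈-filter⁻ (∁? (primitive? _≟ᶠ_)) u∈ in
                   nonprimitive∈periodicWords L h _ 1≤L L≤ u∈words nonprim)
          (length-periodicWords 1≤n L (suc h))

module Splitting where

  open import Data.Empty using (⊥-elim)
  open import Data.Fin using (Fin)
  open import Data.List using (List; []; _++_; length; take; drop)
  open import Data.List.Properties using (length-++; ++-assoc; ++-identityʳ; take++drop≡id; length-drop; take-take)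
  open import Data.Nat
  open import Data.Nat.Divisibility
  open import Data.Nat.DivMod using (_%_; _/_; m≡m%n+[m/n]*n; m%n<n; m≥n⇒m/n>0)
  open import Data.Nat.Primality using (euclidsLemma; prime?)
  open import Data.Nat.Properties
  open import Data.Nat.Tactic.RingSolver using (solve-∀)
  open import Data.Product using (∃-syntax; _×_; _,_; proj₁)
  open import Data.Sum using (_⊎_; inj₁; inj₂)
  open import Relation.Binary.PropositionalEquality
  open import Relation.Nullary using (¬_)
  open import Relation.Nullary.Decidable using (from-yes)
  open import Defs using (pow; Primitive; Eps2Cond)
  open Primitivity

  3∤m⇒3c∤mc : ∀ m c → 1 ≤ c → ¬ 3 ∣ m → ¬ 3 * c ∣ m * c
  3∤m⇒3c∤mc m (suc c) _ 3∤m 3c∣mc = 3∤m (*-cancelʳ-∣ (suc c) 3c∣mc)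

  3∤m⇒3c∤2mc : ∀ m c → 1 ≤ c → ¬ 3 ∣ m → ¬ 3 * c ∣ 2 * (m * c)
  3∤m⇒3c∤2mc m (suc c) _ 3∤m 3c∣2mc with euclidsLemma 2 m (from-yes (prime? 3))
    (*-cancelʳ-∣ (suc c) (subst (3 * suc c ∣_) (sym (*-assoc 2 m (suc c))) 3c∣2mc))
  ... | inj₁ 3∣2 = <⇒≱ (s≤s (s≤s (s≤s z≤n))) (∣⇒≤ 3∣2)
  ... | inj₂ 3∣m = 3∤m 3∣m

  -- m = 3s + 1 = 2s + (s + 1) or m = 3s + 2 = (2s + 1) + (s + 1).
  nonMultipleOf3-split : ∀ m → 6 ≤ m → ¬ 3 ∣ m →
                         ∃[ s ] (1 ≤ s × (m ≡ 2 * s + suc s ⊎ m ≡ suc (2 * s) + suc s))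
  nonMultipleOf3-split m 6≤m 3∤m with m % 3 | m%n<n m 3 | m≡m%n+[m/n]*n m 3
  ... | 0 | _ | m≡ = ⊥-elim (3∤m (divides (m / 3) m≡))
  ... | 1 | _ | m≡ = m / 3 , m≥n⇒m/n>0 (≤-trans (s≤s (s≤s (s≤s z≤n))) 6≤m) , inj₁ (trans m≡ (ring (m / 3)))
    where
      ring : ∀ s → 1 + s * 3 ≡ 2 * s + suc s
      ring = solve-∀
  ... | 2 | _ | m≡ = m / 3 , m≥n⇒m/n>0 (≤-trans (s≤s (s≤s (s≤s z≤n))) 6≤m) , inj₂ (trans m≡ (ring (m / 3)))
    where
      ring : ∀ s → 2 + s * 3 ≡ suc (2 * s) + suc s
      ring = solve-∀
  ... | suc (suc (suc _)) | s≤s (s≤s (s≤s ())) | _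

  module _ {A : Set} where

    splitPow : ℕ → ℕ → List A → List A × List A
    splitPow l m w = take (2 * l) (pow w m) , drop (2 * l) (pow w m)

    rotate-pow : ∀ (β α : List A) s → pow (β ++ α) (suc s) ≡ β ++ (pow (α ++ β) s ++ α)
    rotate-pow β α zero    = trans (++-assoc β α []) (cong (β ++_) (++-identityʳ α))
    rotate-pow β α (suc s) = begin
      (β ++ α) ++ pow (β ++ α) (suc s)         ≡⟨ cong ((β ++ α) ++_) (rotate-pow β α s) ⟩
      (β ++ α) ++ (β ++ (pow (α ++ β) s ++ α)) ≡⟨ ++-assoc β α _ ⟩
      β ++ (α ++ (β ++ (pow (α ++ β) s ++ α))) ≡⟨ cong (β ++_) (++-assoc α β _) ⟨
      β ++ ((α ++ β) ++ (pow (α ++ β) s ++ α)) ≡⟨ cong (β ++_) (++-assoc (α ++ β) _ α) ⟨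
      β ++ (pow (α ++ β) (suc s) ++ α)         ∎
      where open ≡-Reasoning

    pow-split : ∀ (β α : List A) k s →
                pow (β ++ α) (k + suc s) ≡ (pow (β ++ α) k ++ β) ++ (pow (α ++ β) s ++ α)
    pow-split β α k s = begin
      pow (β ++ α) (k + suc s)                          ≡⟨ pow-+ (β ++ α) k (suc s) ⟩
      pow (β ++ α) k ++ pow (β ++ α) (suc s)            ≡⟨ cong (pow (β ++ α) k ++_) (rotate-pow β α s) ⟩
      pow (β ++ α) k ++ β ++ (pow (α ++ β) s ++ α)      ≡⟨ ++-assoc (pow (β ++ α) k) β _ ⟨
      (pow (β ++ α) k ++ β) ++ (pow (α ++ β) s ++ α)    ∎
      where open ≡-Reasoning

    splitPow-rotation : ∀ (β α : List A) k s l → length (pow (β ++ α) k ++ β) ≡ 2 * l →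
                        splitPow l (k + suc s) (β ++ α) ≡ (pow (β ++ α) k ++ β , pow (α ++ β) s ++ α)
    splitPow-rotation β α k s l |p| rewrite pow-split β α k s | sym |p| =
      cong₂ _,_ (take-length-++ (pow (β ++ α) k ++ β) _) (drop-length-++ (pow (β ++ α) k ++ β) _)

    pow++prefix-hasPeriod : ∀ (β α : List A) k → HasPeriod (pow (β ++ α) k ++ β) (length (β ++ α))
    pow++prefix-hasPeriod β α k = subst (λ z → HasPeriod z (length (β ++ α))) prefix≡
      (HasPeriod-take (length (pow (β ++ α) k) + length β) (pow-hasPeriod (β ++ α) (suc k)))
      where
        open ≡-Reasoning
        x : List A
        x = β ++ α
        prefix≡ : take (length (pow x k) + length β) (pow x (suc k)) ≡ pow x k ++ β
        prefix≡ = begin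
          take (length (pow x k) + length β) (pow x (suc k)) ≡⟨ cong (take _) (pow-sucʳ x k) ⟩
          take (length (pow x k) + length β) (pow x k ++ x)  ≡⟨ take-length+-++ (pow x k) x (length β) ⟩
          pow x k ++ take (length β) x                        ≡⟨ cong (pow x k ++_) (take-length-++ β α) ⟩
          pow x k ++ β                                        ∎

    primitive-pow++prefix : ∀ (β α : List A) k → Primitive (β ++ α) → 1 ≤ k →
                            2 * length (β ++ α) ≤ length (pow (β ++ α) k ++ β) →
                            ¬ (length (β ++ α) ∣ length (pow (β ++ α) k ++ β)) → Primitive (pow (β ++ α) k ++ β)
    primitive-pow++prefix β α k prim 1≤k =
      primitive-extension (length (β ++ α)) _ (≢[]⇒length≥1 (β ++ α) (proj₁ prim))
        (subst Primitive (sym (take-length-pow++ (β ++ α) k β 1≤k)) prim) (pow++prefix-hasPeriod β α k)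

    -- Two primitive words whose powers share a prefix of length ≥ |w| + |w'| coincide (Fine–Wilf).
    splitPow-injective : ∀ {l m m′} (w w′ : List A) → Primitive w → Primitive w′ → 1 ≤ m → 1 ≤ m′ →
                         length w + length w′ ≤ 2 * l → 2 * l ≤ m * length w → 2 * l ≤ m′ * length w′ →
                         splitPow l m w ≡ splitPow l m′ w′ → w ≡ w′
    splitPow-injective {l} {m} {m′} w w′ primW primW′ 1≤m 1≤m′ sum≤ 2l≤ 2l≤′ split≡ = begin
      w                         ≡⟨ prefix w m primW 1≤m |w|≤ ⟨
      take (length w) u         ≡⟨ cong (λ z → take z u) |w|≡|w′| ⟩
      take (length w′) u        ≡⟨ cong (take (length w′)) (cong proj₁ split≡) ⟩
      take (length w′) u′       ≡⟨ prefix w′ m′ primW′ 1≤m′ |w′|≤ ⟩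
      w′                        ∎
      where
        open ≡-Reasoning
        u : List A
        u = proj₁ (splitPow l m w)
        u′ : List A
        u′ = proj₁ (splitPow l m′ w′)
        |w|≤ : length w ≤ 2 * l
        |w|≤ = m+n≤o⇒m≤o (length w) sum≤
        |w′|≤ : length w′ ≤ 2 * l
        |w′|≤ = m+n≤o⇒n≤o (length w) sum≤
        prefix : ∀ v k → Primitive v → 1 ≤ k → length v ≤ 2 * l → take (length v) (take (2 * l) (pow v k)) ≡ v
        prefix v k _ 1≤k v≤ = trans (take-take (length v) (2 * l) (pow v k))
          (trans (cong (λ z → take z (pow v k)) (m≤n⇒m⊓n≡m v≤))
            (trans (cong (take (length v)) (sym (++-identityʳ (pow v k)))) (take-length-pow++ v k [] 1≤k)))
        periodOfPrefix : ∀ v k → length v ≤ 2 * l → 2 * l ≤ k * length v →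
                         HasPeriod (take (2 * l) (pow v k)) (length v) × length (take (2 * l) (pow v k)) ≡ 2 * l
        periodOfPrefix v k _ 2l≤kv =
          HasPeriod-take (2 * l) (pow-hasPeriod v k) ,
          ≤length⇒length-take≡ (pow v k) (subst (2 * l ≤_) (sym (length-pow v k)) 2l≤kv)
        perW : HasPeriod (take (2 * l) (pow w m)) (length w) × length (take (2 * l) (pow w m)) ≡ 2 * l
        perW = periodOfPrefix w m |w|≤ 2l≤
        perW′ : HasPeriod (take (2 * l) (pow w′ m′)) (length w′) × length (take (2 * l) (pow w′ m′)) ≡ 2 * l
        perW′ = periodOfPrefix w′ m′ |w′|≤ 2l≤′
        |w|≡|w′| : length w ≡ length w′
        |w|≡|w′| with commonPeriod {u = u} (≢[]⇒length≥1 w (proj₁ primW)) (proj₁ perW)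
                        (subst (λ z → HasPeriod z (length w′)) (sym (cong proj₁ split≡)) (proj₁ perW′))
                        (subst (_ ≤_) (sym (Data.Product.proj₂ perW)) sum≤)
        ... | g , _ , g∣w , g∣w′ , perG = trans (sym (g≡ w m primW 1≤m |w|≤ g∣w (HasPeriod-take (length w) perG)))
                                                (g≡ w′ m′ primW′ 1≤m′ |w′|≤ g∣w′
                                                   (HasPeriod-take (length w′) (subst (λ z → HasPeriod z g) (cong proj₁ split≡) perG)))
          where
            g≡ : ∀ v k → Primitive v → 1 ≤ k → length v ≤ 2 * l → g ∣ length v →
                 HasPeriod (take (length v) (take (2 * l) (pow v k))) g → g ≡ length v
            g≡ v k primV 1≤k v≤ g∣v perV =
              primitive-period v primV (subst (λ z → HasPeriod z g) (prefix v k primV 1≤k v≤) perV) g∣v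

  module Pairs (n : ℕ) where

    Word : Set
    Word = List (Fin n)

    Shape : Word → Word → ℕ → ℕ → Set
    Shape β α k s = (k ≡ 2 * s × length β ≡ 2 * length α) ⊎ (k ≡ suc (2 * s) × length α ≡ 2 * length β)

    rotation-eps2Cond : ∀ (β α : Word) k s c → 1 ≤ c → length (β ++ α) ≡ 3 * c → Primitive (β ++ α) →
                        α ≢ [] → β ≢ [] → 1 ≤ k → 1 ≤ s → 6 ≤ k + suc s → ¬ 3 ∣ (k + suc s) →
                        length (pow (β ++ α) k ++ β) ≡ 2 * ((k + suc s) * c) → Shape β α k s →
                        Eps2Cond n ((k + suc s) * c) (pow (β ++ α) k ++ β , pow (α ++ β) s ++ α)
    rotation-eps2Cond β α k s c 1≤c |βα| primβα α≢[] β≢[] 1≤k 1≤s 6≤m 3∤m |p| shape =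
      primP , primQ , |p| , |q| , nonprimPQ , α , β , s , α≢[] , β≢[] , primαβ , 1≤s , refl , shapeCond shape
      where
        m : ℕ
        m = k + suc s
        l : ℕ
        l = m * c
        p : Word
        p = pow (β ++ α) k ++ β
        q : Word
        q = pow (α ++ β) s ++ α
        primαβ : Primitive (α ++ β)
        primαβ = primitive-rotate β α primβα
        |αβ| : length (α ++ β) ≡ 3 * c
        |αβ| = trans (length-++ α) (trans (+-comm (length α) (length β)) (trans (sym (length-++ β)) |βα|))
        |q| : length q ≡ l
        |q| = +-cancelˡ-≡ (2 * l) (length q) l (begin
          2 * l + length q      ≡⟨ cong (_+ length q) |p| ⟨
          length p + length q   ≡⟨ length-++ p ⟨
          length (p ++ q)       ≡⟨ cong length (pow-split β α k s) ⟨
          length (pow (β ++ α) m) ≡⟨ length-pow (β ++ α) m ⟩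
          m * length (β ++ α)   ≡⟨ cong (m *_) |βα| ⟩
          m * (3 * c)           ≡⟨ ring m c ⟩
          2 * l + l             ∎)
          where
            open ≡-Reasoning
            ring : ∀ m c → m * (3 * c) ≡ 2 * (m * c) + m * c
            ring = solve-∀
        6c≤l : 2 * (3 * c) ≤ l
        6c≤l = subst (_≤ l) (*-assoc 2 3 c) (*-monoˡ-≤ c 6≤m)
        primP : Primitive p
        primP = primitive-pow++prefix β α k primβα 1≤k
          (subst₂ _≤_ (cong (2 *_) (sym |βα|)) (sym |p|) (*-monoʳ-≤ 2 (≤-trans (m≤m+n (3 * c) (1 * (3 * c))) 6c≤l)))
          (subst₂ (λ a b → ¬ a ∣ b) (sym |βα|) (sym |p|) (3∤m⇒3c∤2mc m c 1≤c 3∤m))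
        primQ : Primitive q
        primQ = primitive-pow++prefix α β s primαβ 1≤s
          (subst₂ _≤_ (cong (2 *_) (sym |αβ|)) (sym |q|) 6c≤l)
          (subst₂ (λ a b → ¬ a ∣ b) (sym |αβ|) (sym |q|) (3∤m⇒3c∤mc m c 1≤c 3∤m))
        nonprimPQ : ¬ Primitive (p ++ q)
        nonprimPQ = subst (λ z → ¬ Primitive z) (pow-split β α k s)
          (pow-nonprimitive (β ++ α) m (≤-trans (s≤s (s≤s z≤n)) 6≤m))
        shapeCond : Shape β α k s →
          (p ≡ pow (β ++ α) (2 * s) ++ β × length β ≡ 2 * length α) ⊎
          (p ≡ pow (β ++ α) (suc (2 * s)) ++ β × length α ≡ 2 * length β)
        shapeCond (inj₁ (refl , |β|)) = inj₁ (refl , |β|)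
        shapeCond (inj₂ (refl , |α|)) = inj₂ (refl , |α|)

    private
      splitPow-sound-at : ∀ (w : Word) c j k s → 1 ≤ c → length w ≡ 3 * c → Primitive w → 1 ≤ j → j < 3 * c →
                          1 ≤ k → 1 ≤ s → 6 ≤ k + suc s → ¬ 3 ∣ (k + suc s) →
                          k * (3 * c) + j ≡ 2 * ((k + suc s) * c) → Shape (take j w) (drop j w) k s →
                          Eps2Cond n ((k + suc s) * c) (splitPow ((k + suc s) * c) (k + suc s) w)
      splitPow-sound-at w c j k s 1≤c |w| primW 1≤j j<3c 1≤k 1≤s 6≤m 3∤m |p| shape =
        subst (λ x → Eps2Cond n l (splitPow l (k + suc s) x)) (take++drop≡id j w)
          (subst (Eps2Cond n l) (sym (splitPow-rotation β α k s l |p|′))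
            (rotation-eps2Cond β α k s c 1≤c |βα| (subst Primitive (sym (take++drop≡id j w)) primW)
              (length≥1⇒≢[] α (subst (1 ≤_) (sym |α|) (m<n⇒0<n∸m j<|w|)))
              (length≥1⇒≢[] β (subst (1 ≤_) (sym |β|) 1≤j))
              1≤k 1≤s 6≤m 3∤m |p|′ shape))
        where
          l : ℕ
          l = (k + suc s) * c
          β : Word
          β = take j w
          α : Word
          α = drop j w
          j<|w| : j < length w
          j<|w| = subst (j <_) (sym |w|) j<3c
          |β| : length β ≡ j
          |β| = ≤length⇒length-take≡ w (<⇒≤ j<|w|)
          |α| : length α ≡ length w ∸ j
          |α| = length-drop j w
          |βα| : length (β ++ α) ≡ 3 * c
          |βα| = trans (cong length (take++drop≡id j w)) |w|
          |p|′ : length (pow (β ++ α) k ++ β) ≡ 2 * l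
          |p|′ = trans (length-++ (pow (β ++ α) k))
                   (trans (cong₂ _+_ (trans (length-pow (β ++ α) k) (cong (k *_) |βα|)) |β|) |p|)

    splitPow-sound : ∀ (w : Word) c m → 1 ≤ c → length w ≡ 3 * c → Primitive w → 6 ≤ m → ¬ 3 ∣ m →
                     Eps2Cond n (m * c) (splitPow (m * c) m w)
    splitPow-sound w c m 1≤c |w| primW 6≤m 3∤m with nonMultipleOf3-split m 6≤m 3∤m
    ... | s , 1≤s , inj₁ refl =
      splitPow-sound-at w c (2 * c) (2 * s) s 1≤c |w| primW (≤-trans 1≤c (m≤m+n c _)) (m<n+m (2 * c) 1≤c)
        (≤-trans 1≤s (m≤m+n s _)) 1≤s 6≤m 3∤m (ring s c) (inj₁ (refl , trans |take| (cong (2 *_) (sym |drop|))))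
      where
        ring : ∀ s c → 2 * s * (3 * c) + 2 * c ≡ 2 * ((2 * s + suc s) * c)
        ring = solve-∀
        |take| : length (take (2 * c) w) ≡ 2 * c
        |take| = ≤length⇒length-take≡ w (subst (2 * c ≤_) (sym |w|) (m≤n+m (2 * c) c))
        |drop| : length (drop (2 * c) w) ≡ c
        |drop| = trans (length-drop (2 * c) w) (trans (cong (_∸ 2 * c) |w|) (m+n∸n≡m c (2 * c)))
    ... | s , 1≤s , inj₂ refl =
      splitPow-sound-at w c c (suc (2 * s)) s 1≤c |w| primW 1≤c (m<m+n c (≤-trans 1≤c (m≤m+n c _)))
        (s≤s z≤n) 1≤s 6≤m 3∤m (ring s c) (inj₂ (refl , trans |drop| (cong (2 *_) (sym |take|))))
      where
        ring : ∀ s c → suc (2 * s) * (3 * c) + c ≡ 2 * ((suc (2 * s) + suc s) * c)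
        ring = solve-∀
        |take| : length (take c w) ≡ c
        |take| = ≤length⇒length-take≡ w (subst (c ≤_) (sym |w|) (m≤m+n c (2 * c)))
        |drop| : length (drop c w) ≡ 2 * c
        |drop| = trans (length-drop c w) (trans (cong (_∸ c) |w|) (m+n∸m≡n c (2 * c)))

    eps2Cond-complete : ∀ {l} x → Eps2Cond n l x →
                        ∃[ w ] ∃[ c ] ∃[ m ] (Primitive w × length w ≡ 3 * c × 2 ≤ m × m * c ≡ l × x ≡ splitPow l m w)
    eps2Cond-complete {l} _ (_ , _ , |p| , |q| , _ , α , β , s , _ , _ , primαβ , 1≤s , refl , inj₁ (refl , |β|)) =
      β ++ α , length α , 2 * s + suc s , primitive-rotate α β primαβ , |βα| ,
      ≤-trans (s≤s 1≤s) (m≤n+m (suc s) (2 * s)) , mc≡l , sym (splitPow-rotation β α (2 * s) s l |p|)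
      where
        c : ℕ
        c = length α
        |βα| : length (β ++ α) ≡ 3 * c
        |βα| = trans (length-++ β) (trans (cong (_+ c) |β|) (+-comm (2 * c) c))
        mc≡l : (2 * s + suc s) * c ≡ l
        mc≡l = sym (trans (sym |q|) (trans (length-++ (pow (α ++ β) s))
                 (trans (cong (_+ c) (trans (length-pow (α ++ β) s) (cong (s *_) (trans (length-++ α) (cong (c +_) |β|)))))
                   (ring s c))))
          where
            ring : ∀ s c → s * (c + 2 * c) + c ≡ (2 * s + suc s) * c
            ring = solve-∀
    eps2Cond-complete {l} _ (_ , _ , |p| , |q| , _ , α , β , s , _ , _ , primαβ , 1≤s , refl , inj₂ (refl , |α|)) =
      β ++ α , length β , suc (2 * s) + suc s , primitive-rotate α β primαβ , |βα| ,
      s≤s (≤-trans (≤-trans 1≤s (n≤1+n s)) (m≤n+m (suc s) (2 * s))) , mc≡l , sym (splitPow-rotation β α (suc (2 * s)) s l |p|)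
      where
        c : ℕ
        c = length β
        |βα| : length (β ++ α) ≡ 3 * c
        |βα| = trans (length-++ β) (cong (c +_) |α|)
        mc≡l : (suc (2 * s) + suc s) * c ≡ l
        mc≡l = sym (trans (sym |q|) (trans (length-++ (pow (α ++ β) s))
                 (trans (cong₂ _+_ (trans (length-pow (α ++ β) s) (cong (s *_) (trans (length-++ α) (cong (_+ c) |α|)))) |α|)
                   (ring s c))))
          where
            ring : ∀ s c → s * (2 * c + c) + 2 * c ≡ (suc (2 * s) + suc s) * c
            ring = solve-∀

module Primes where

  open import Data.Empty using (⊥-elim)
  open import Data.List using ([]; _∷_; _∷ʳ_; _++_; length; filter; upTo)
  open import Data.List.Properties using (length-++; filter-++; upTo-∷ʳ; length-filter; length-upTo)
  open import Data.Nat
  open import Data.Nat.Coprimality using (Coprime; coprime-divisor) renaming (sym to coprime-sym)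
  open import Data.Nat.Divisibility
  open import Data.Nat.Primality using (Prime; prime?; euclidsLemma; prime⇒irreducible; prime⇒nonZero)
  open import Data.Nat.Properties
  open import Data.Product using (_,_)
  open import Data.Sum using (_⊎_; inj₁; inj₂)
  open import Relation.Binary.PropositionalEquality
  open import Relation.Nullary using (¬_; yes; no)
  open import Relation.Nullary.Decidable using (from-yes)
  open import Defs using (primeCountBelow; IsNthPrime; InΛ; IsDelta)

  primeCountBelow-suc : ∀ x → primeCountBelow x ≤ primeCountBelow (suc x)
  primeCountBelow-suc x = begin
    length (filter prime? (upTo x))                                    ≤⟨ m≤m+n _ _ ⟩
    length (filter prime? (upTo x)) + length (filter prime? (x ∷ []))  ≡⟨ length-++ (filter prime? (upTo x)) ⟨
    length (filter prime? (upTo x) ++ filter prime? (x ∷ []))          ≡⟨ cong length (filter-++ prime? (upTo x) (x ∷ [])) ⟨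
    length (filter prime? (upTo x ∷ʳ x))                               ≡⟨ cong (λ z → length (filter prime? z)) (upTo-∷ʳ x) ⟩
    length (filter prime? (upTo (suc x)))                              ∎
    where open ≤-Reasoning

  primeCountBelow-mono : ∀ {x y} → x ≤ y → primeCountBelow x ≤ primeCountBelow y
  primeCountBelow-mono {x} {y} x≤y with m≤n⇒∃[o]m+o≡n x≤y
  ... | d , refl = go d
    where
      go : ∀ d → primeCountBelow x ≤ primeCountBelow (x + d)
      go zero    = ≤-reflexive (cong primeCountBelow (sym (+-identityʳ x)))
      go (suc d) = ≤-trans (go d) (subst (λ z → primeCountBelow (x + d) ≤ primeCountBelow z) (sym (+-suc x d))
                                     (primeCountBelow-suc (x + d)))

  primeCountBelow≤ : ∀ x → primeCountBelow x ≤ x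
  primeCountBelow≤ x = subst (primeCountBelow x ≤_) (length-upTo x) (length-filter prime? (upTo x))

  nthPrime-< : ∀ {k p P} → IsNthPrime k p → IsNthPrime (suc k) P → p < P
  nthPrime-< {p = p} {P} (_ , πp) (_ , πP) with p <? P
  ... | yes p<P = p<P
  ... | no  p≮P = ⊥-elim (<-irrefl refl
        (subst (_≤ primeCountBelow p) (trans (suc-injective πP) (sym πp)) (primeCountBelow-mono (≮⇒≥ p≮P))))

  index≤nthPrime : ∀ {k P} → IsNthPrime (suc k) P → k ≤ P
  index≤nthPrime {P = P} (_ , πP) = subst (_≤ P) (suc-injective πP) (primeCountBelow≤ P)

  -- Only 2, 3, 5, 7 lie below 8, so from the fifth prime on p ≥ 8.
  nthPrime≥8 : ∀ {k p} → 5 ≤ k → IsNthPrime k p → 8 ≤ p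
  nthPrime≥8 {p = p} 5≤k (_ , πp) with 8 ≤? p
  ... | yes 8≤p = 8≤p
  ... | no  8≰p = ⊥-elim (<⇒≱ 5≤k (subst (_≤ 4) πp (s≤s (primeCountBelow-mono {y = 7} (s≤s⁻¹ (≰⇒> 8≰p))))))

  prime≥4⇒3∤ : ∀ {q} → Prime q → 4 ≤ q → ¬ 3 ∣ q
  prime≥4⇒3∤ primeQ 4≤q 3∣q with prime⇒irreducible primeQ 3∣q
  ... | inj₂ refl = <-irrefl refl 4≤q

  3∤*-3∤ : ∀ {a b} → ¬ 3 ∣ a → ¬ 3 ∣ b → ¬ 3 ∣ a * b
  3∤*-3∤ {a} {b} 3∤a 3∤b 3∣ab with euclidsLemma a b (from-yes (prime? 3)) 3∣ab
  ... | inj₁ 3∣a = 3∤a 3∣a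
  ... | inj₂ 3∣b = 3∤b 3∣b

  prime∤⇒coprime : ∀ {p c} → Prime p → ¬ p ∣ c → Coprime p c
  prime∤⇒coprime primeP p∤c (i∣p , i∣c) with prime⇒irreducible primeP i∣p
  ... | inj₁ i≡1 = i≡1
  ... | inj₂ refl = ⊥-elim (p∤c i∣c)

  semiprime-divisors : ∀ {p P c} → Prime p → Prime P → c ∣ p * P → c ≡ 1 ⊎ c ≡ p ⊎ c ≡ P ⊎ c ≡ p * P
  semiprime-divisors {p} {P} {c} primep primeP c∣pP with p ∣? c
  ... | no p∤c with prime⇒irreducible primeP (coprime-divisor (coprime-sym (prime∤⇒coprime primep p∤c)) c∣pP)
  ...   | inj₁ c≡1 = inj₁ c≡1
  ...   | inj₂ c≡P = inj₂ (inj₂ (inj₁ c≡P))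
  semiprime-divisors {p} {P} primep primeP c∣pP | yes (divides f refl)
    with prime⇒irreducible primeP (*-cancelʳ-∣ {f} p {{prime⇒nonZero primep}} (subst (f * p ∣_) (*-comm p P) c∣pP))
  ...   | inj₁ refl = inj₂ (inj₁ (+-identityʳ p))
  ...   | inj₂ refl = inj₂ (inj₂ (inj₂ (*-comm P p)))

  δ-semiprime : ∀ {p P d} → Prime p → Prime P → p < P → 4 ≤ p → IsDelta (p * P) d → d ≡ p
  δ-semiprime {p} {P} primep primeP p<P 4≤p ((d∣pP , _ , 4≤d) , minimal) with semiprime-divisors primep primeP d∣pP
  ... | inj₁ refl                = ⊥-elim (<⇒≱ (s≤s (s≤s z≤n)) 4≤d)
  ... | inj₂ (inj₁ d≡p)          = d≡p
  ... | inj₂ (inj₂ (inj₁ refl))  = ⊥-elim (<⇒≱ p<P (minimal p p∈Λ))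
    where
      p∈Λ : InΛ (p * P) p
      p∈Λ = m∣m*n P , prime≥4⇒3∤ primep 4≤p , 4≤p
  ... | inj₂ (inj₂ (inj₂ refl))  = ⊥-elim (<⇒≱ (<-≤-trans p<P (m≤n*m P p)) (minimal p p∈Λ))
    where
      p∈Λ : InΛ (p * P) p
      p∈Λ = m∣m*n P , prime≥4⇒3∤ primep 4≤p , 4≤p
      instance _ = prime⇒nonZero primep

module Semiprimes where

  open import Data.Empty using (⊥-elim)
  open import Data.List using (List; _++_; length; map)
  open import Data.List.Properties using (length-++; length-map)
  open import Data.List.Membership.Propositional using (_∈_)
  open import Data.List.Membership.Propositional.Properties using (∈-map⁺; ∈-map⁻; ∈-++⁺ˡ; ∈-++⁺ʳ; ∈-++⁻)
  open import Data.List.Relation.Binary.Disjoint.Propositional using (Disjoint)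
  open import Data.List.Relation.Unary.Unique.Propositional using (Unique)
  open import Data.List.Relation.Unary.Unique.Propositional.Properties using (++⁺)
  open import Data.Nat
  open import Data.Nat.Divisibility using (_∣_; divides)
  open import Data.Nat.Primality using (Prime)
  open import Data.Nat.Properties
  open import Data.Nat.Tactic.RingSolver using (solve-∀)
  open import Data.Product using (_×_; _,_; proj₁; proj₂)
  open import Data.Sum using (inj₁; inj₂)
  open import Relation.Binary.PropositionalEquality
  open import Relation.Nullary using (¬_)
  open import Defs using (Primitive; Eps2Cond; Eps2)
  open Primitivity
  open Counting
  open Splitting
  open Primes

  module SemiprimeCount (n : ℕ) {p P : ℕ} (primep : Prime p) (primeP : Prime P) (8≤p : 8 ≤ p) (p<P : p < P) where

    open Enumeration n
    open Pairs n using (splitPow-sound; eps2Cond-complete)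

    l : ℕ
    l = p * P

    π : ℕ → ℕ
    π L = length (primitiveWords L)

    block : ℕ → ℕ → List (Word × Word)
    block c m = map (splitPow l m) (primitiveWords (3 * c))

    1≤p : 1 ≤ p
    1≤p = ≤-trans (s≤s z≤n) 8≤p

    p≤P : p ≤ P
    p≤P = <⇒≤ p<P

    1≤P : 1 ≤ P
    1≤P = ≤-trans 1≤p p≤P

    instance
      nonZero-p : NonZero p
      nonZero-p = >-nonZero 1≤p
      nonZero-P : NonZero P
      nonZero-P = >-nonZero 1≤P

    p≤l : p ≤ l
    p≤l = m≤m*n p P

    instance
      nonZero-l : NonZero l
      nonZero-l = >-nonZero (≤-trans 1≤p p≤l)

    block-injective : ∀ {c m c′ m′} → m * c ≡ l → m′ * c′ ≡ l → c ≤ P → c′ ≤ P →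
                      ∀ {w w′} → w ∈ primitiveWords (3 * c) → w′ ∈ primitiveWords (3 * c′) →
                      splitPow l m w ≡ splitPow l m′ w′ → w ≡ w′
    block-injective {c} {m} {c′} {m′} mc≡l m′c′≡l c≤P c′≤P {w} {w′} w∈ w′∈ =
      splitPow-injective {l = l} {m} {m′} _ _ primW primW′ (1≤cofactor {m} {c} mc≡l) (1≤cofactor {m′} {c′} m′c′≡l)
        (subst₂ (λ a b → a + b ≤ 2 * l) (sym |w|) (sym |w′|)
          (≤-trans (+-mono-≤ (*-monoʳ-≤ 3 c≤P) (*-monoʳ-≤ 3 c′≤P)) 3P+3P≤2l))
        (subst (λ a → 2 * l ≤ m * a) (sym |w|) (2l≤3mc {m} {c} mc≡l))
        (subst (λ a → 2 * l ≤ m′ * a) (sym |w′|) (2l≤3mc {m′} {c′} m′c′≡l))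
      where
        |w| : length w ≡ 3 * c
        |w| = proj₁ (∈-primitiveWords⁻ (3 * c) w∈)
        primW : Primitive w
        primW = proj₂ (∈-primitiveWords⁻ (3 * c) w∈)
        |w′| : length w′ ≡ 3 * c′
        |w′| = proj₁ (∈-primitiveWords⁻ (3 * c′) w′∈)
        primW′ : Primitive w′
        primW′ = proj₂ (∈-primitiveWords⁻ (3 * c′) w′∈)
        3P+3P≤2l : 3 * P + 3 * P ≤ 2 * l
        3P+3P≤2l = begin
          3 * P + 3 * P ≡⟨ ring P ⟩
          (2 * 3) * P   ≤⟨ *-monoˡ-≤ P (*-monoʳ-≤ 2 (≤-trans (m≤m+n 3 5) 8≤p)) ⟩
          (2 * p) * P   ≡⟨ *-assoc 2 p P ⟩
          2 * l         ∎
          where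
            open ≤-Reasoning
            ring : ∀ P → 3 * P + 3 * P ≡ (2 * 3) * P
            ring = solve-∀
        1≤cofactor : ∀ {m c} → m * c ≡ l → 1 ≤ m
        1≤cofactor {zero}  0≡l = ⊥-elim (<-irrefl 0≡l (>-nonZero⁻¹ l))
        1≤cofactor {suc m} _   = s≤s z≤n
        2l≤3mc : ∀ {m c} → m * c ≡ l → 2 * l ≤ m * (3 * c)
        2l≤3mc {m} {c} mc≡l = subst₂ (λ a b → 2 * a ≤ b) mc≡l (sym (ring m c)) (m≤m+n (2 * (m * c)) (m * c))
          where
            ring : ∀ m c → m * (3 * c) ≡ 2 * (m * c) + m * c
            ring = solve-∀

    block-unique : ∀ {c m} → m * c ≡ l → c ≤ P → Unique (block c m)
    block-unique {c} {m} mc≡l c≤P =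
      Unique-map⁺ (splitPow l m) (primitiveWords-unique (3 * c)) (block-injective {c} {m} {c} {m} mc≡l mc≡l c≤P c≤P)

    blocks-disjoint : ∀ {c m c′ m′} → m * c ≡ l → m′ * c′ ≡ l → c ≤ P → c′ ≤ P → c ≢ c′ →
                      Disjoint (block c m) (block c′ m′)
    blocks-disjoint {c} {m} {c′} {m′} mc≡l m′c′≡l c≤P c′≤P c≢c′ (x∈ , x∈′)
      with ∈-map⁻ (splitPow l m) x∈ | ∈-map⁻ (splitPow l m′) x∈′
    ... | w , w∈ , x≡ | w′ , w′∈ , x≡′ = c≢c′ (*-cancelˡ-≡ c c′ 3 (begin
      3 * c      ≡⟨ proj₁ (∈-primitiveWords⁻ (3 * c) w∈) ⟨
      length w   ≡⟨ cong length w≡w′ ⟩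
      length w′  ≡⟨ proj₁ (∈-primitiveWords⁻ (3 * c′) w′∈) ⟩
      3 * c′     ∎))
      where
        open ≡-Reasoning
        w≡w′ : w ≡ w′
        w≡w′ = block-injective {c} {m} {c′} {m′} mc≡l m′c′≡l c≤P c′≤P w∈ w′∈ (trans (sym x≡) x≡′)

    block-sound : ∀ {c m} → m * c ≡ l → 1 ≤ c → 6 ≤ m → ¬ 3 ∣ m → ∀ {x} → x ∈ block c m → Eps2Cond n l x
    block-sound {c} {m} mc≡l 1≤c 6≤m 3∤m x∈ with ∈-map⁻ (splitPow l m) x∈
    ... | w , w∈ , refl = subst (λ l′ → Eps2Cond n l′ (splitPow l′ m w)) mc≡l
      (splitPow-sound w c m 1≤c (proj₁ (∈-primitiveWords⁻ (3 * c) w∈)) (proj₂ (∈-primitiveWords⁻ (3 * c) w∈)) 6≤m 3∤m)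

    ∈-block : ∀ c {m m′} (w : Word) → Primitive w → length w ≡ 3 * c → m ≡ m′ → splitPow l m w ∈ block c m′
    ∈-block c w primW |w| refl = ∈-map⁺ _ (∈-primitiveWords⁺ w |w| primW)

    pairs : List (Word × Word)
    pairs = block P p ++ (block p P ++ block 1 l)

    3∤p : ¬ 3 ∣ p
    3∤p = prime≥4⇒3∤ primep (≤-trans (m≤m+n 4 4) 8≤p)

    3∤P : ¬ 3 ∣ P
    3∤P = prime≥4⇒3∤ primeP (≤-trans (m≤m+n 4 4) (≤-trans 8≤p p≤P))

    6≤p : 6 ≤ p
    6≤p = ≤-trans (m≤m+n 6 2) 8≤p

    Pp≡l : P * p ≡ l
    Pp≡l = *-comm P p

    pairs-sound : ∀ {x} → x ∈ pairs → Eps2Cond n l x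
    pairs-sound x∈ with ∈-++⁻ (block P p) x∈
    ... | inj₁ x∈₁ = block-sound {P} {p} refl 1≤P 6≤p 3∤p x∈₁
    ... | inj₂ x∈₂₃ with ∈-++⁻ (block p P) x∈₂₃
    ...   | inj₁ x∈₂ = block-sound {p} {P} Pp≡l 1≤p (≤-trans 6≤p p≤P) 3∤P x∈₂
    ...   | inj₂ x∈₃ = block-sound {1} {l} (*-identityʳ l) ≤-refl (≤-trans 6≤p p≤l) (3∤*-3∤ 3∤p 3∤P) x∈₃

    pairs-complete : ∀ x → Eps2Cond n l x → x ∈ pairs
    pairs-complete x cond with eps2Cond-complete x cond
    ... | w , c , m , primW , |w| , 2≤m , mc≡l , refl with semiprime-divisors primep primeP (divides m (sym mc≡l))
    ...   | inj₁ refl = ∈-++⁺ʳ (block P p) (∈-++⁺ʳ (block p P) (∈-block 1 w primW |w| (trans (sym (*-identityʳ m)) mc≡l)))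
    ...   | inj₂ (inj₁ refl) = ∈-++⁺ʳ (block P p) (∈-++⁺ˡ (∈-block p w primW |w| (*-cancelʳ-≡ m P p (trans mc≡l (sym Pp≡l)))))
    ...   | inj₂ (inj₂ (inj₁ refl)) = ∈-++⁺ˡ (∈-block P w primW |w| (*-cancelʳ-≡ m p P mc≡l))
    ...   | inj₂ (inj₂ (inj₂ refl)) = ⊥-elim (<-irrefl (sym (*-cancelʳ-≡ m 1 l (trans mc≡l (sym (*-identityˡ l))))) 2≤m)

    pairs-unique : Unique pairs
    pairs-unique =
      ++⁺ (block-unique {P} {p} refl ≤-refl)
          (++⁺ (block-unique {p} {P} Pp≡l p≤P) (block-unique {1} {l} (*-identityʳ l) 1≤P)
               (blocks-disjoint {p} {P} {1} {l} Pp≡l (*-identityʳ l) p≤P 1≤P p≢1))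
          (Disjoint-++ʳ (blocks-disjoint {P} {p} {p} {P} refl Pp≡l ≤-refl p≤P (>⇒≢ p<P))
                        (blocks-disjoint {P} {p} {1} {l} refl (*-identityʳ l) ≤-refl 1≤P P≢1))
      where
        p≢1 : p ≢ 1
        p≢1 = >⇒≢ (≤-trans (s≤s (s≤s z≤n)) 8≤p)
        P≢1 : P ≢ 1
        P≢1 = >⇒≢ (≤-trans (s≤s (s≤s z≤n)) (≤-trans 8≤p p≤P))

    ε₂-semiprime : Eps2 n l (π (3 * P) + (π (3 * p) + π 3))
    ε₂-semiprime = subst (Eps2 n l) |pairs| (Unique⇒HasCount pairs-unique pairs-sound pairs-complete)
      where
        |block| : ∀ c m → length (block c m) ≡ π (3 * c)
        |block| c m = length-map (splitPow l m) (primitiveWords (3 * c))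
        |pairs| : length pairs ≡ π (3 * P) + (π (3 * p) + π 3)
        |pairs| = trans (length-++ (block P p))
          (cong₂ _+_ (|block| P p) (trans (length-++ (block p P)) (cong₂ _+_ (|block| p P) (|block| 1 l))))

module Growth where

  open import Relation.Nullary using (contradiction)
  open import Data.Nat
  open import Data.Nat.Properties
  open import Data.Nat.Tactic.RingSolver using (solve-∀)
  open import Data.Product using (_,_)
  open import Relation.Binary.PropositionalEquality

  private
    square≤4^ : ∀ X → suc X * suc X ≤ 4 ^ X
    square≤4^ zero    = s≤s z≤n
    square≤4^ (suc X) = ≤-trans (subst (suc (suc X) * suc (suc X) ≤_) (sym (ring X)) (m≤m+n _ _))
                                (*-monoʳ-≤ 4 (square≤4^ X))
      where
        ring : ∀ X → 4 * (suc X * suc X) ≡ suc (suc X) * suc (suc X) + (3 * X * X + 4 * X)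
        ring = solve-∀

  linear<2^ : ∀ X t → 2 * X + 4 ≤ t → X * (t + 2) < 2 ^ t
  linear<2^ X t 2X+4≤t with m≤n⇒∃[o]m+o≡n 2X+4≤t
  ... | d , refl = go d
    where
      base : X * ((2 * X + 4) + 2) < 2 ^ (2 * X + 4)
      base = begin-strict
        X * ((2 * X + 4) + 2)                                  <⟨ m<m+n _ z<s ⟩
        X * ((2 * X + 4) + 2) + suc (14 * X * X + 26 * X + 15) ≡⟨ ring X ⟩
        16 * (suc X * suc X)                                   ≤⟨ *-monoʳ-≤ 16 (square≤4^ X) ⟩
        16 * 4 ^ X                                             ≡⟨ cong (16 *_) (^-*-assoc 2 2 X) ⟩
        16 * 2 ^ (2 * X)                                       ≡⟨ *-comm 16 (2 ^ (2 * X)) ⟩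
        2 ^ (2 * X) * 2 ^ 4                                    ≡⟨ ^-distribˡ-+-* 2 (2 * X) 4 ⟨
        2 ^ (2 * X + 4)                                        ∎
        where
          open ≤-Reasoning
          ring : ∀ X → X * ((2 * X + 4) + 2) + suc (14 * X * X + 26 * X + 15) ≡ 16 * (suc X * suc X)
          ring = solve-∀
      step : ∀ t → X * (t + 2) < 2 ^ t → X * (suc t + 2) < 2 ^ suc t
      step t hyp = begin-strict
        X * (suc t + 2)    ≤⟨ *-monoʳ-≤ X (subst (suc t + 2 ≤_) (ring₁ t) (m≤m+n (suc t + 2) (suc t))) ⟩
        X * (2 * (t + 2))  ≡⟨ ring₂ X t ⟩
        2 * (X * (t + 2))  <⟨ *-monoʳ-< 2 hyp ⟩
        2 * 2 ^ t          ∎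
        where
          open ≤-Reasoning
          ring₁ : ∀ t → suc t + 2 + suc t ≡ 2 * (t + 2)
          ring₁ = solve-∀
          ring₂ : ∀ X t → X * (2 * (t + 2)) ≡ 2 * (X * (t + 2))
          ring₂ = solve-∀
      go : ∀ d → X * ((2 * X + 4 + d) + 2) < 2 ^ (2 * X + 4 + d)
      go zero    = subst (λ z → X * (z + 2) < 2 ^ z) (sym (+-identityʳ (2 * X + 4))) base
      go (suc d) = subst (λ z → X * (z + 2) < 2 ^ z) (sym (+-suc (2 * X + 4) d)) (step _ (go d))

  -- The error term (h + 1) n^(h+1) of the primitive-word count is negligible against n^(2h).
  error<power : ∀ n D h L → 2 ≤ n → 4 * D + 5 ≤ h → 2 * h ≤ L → D * (2 * (suc h * n ^ suc h)) < n ^ L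
  error<power n D zero    L 2≤n 4D+5≤0 2h≤L = contradiction (m+n≤o⇒n≤o (4 * D) 4D+5≤0) λ ()
  error<power n D (suc t) L 2≤n@(s≤s (s≤s _)) 4D+5≤h 2h≤L = begin-strict
    D * (2 * (suc (suc t) * n ^ suc (suc t))) ≡⟨ ring₁ D t (n ^ suc (suc t)) ⟩
    (2 * D) * (t + 2) * n ^ suc (suc t)       <⟨ *-monoˡ-< (n ^ suc (suc t)) ⦃ m^n≢0 n (suc (suc t)) ⦄ (linear<2^ (2 * D) t 4D+4≤t) ⟩
    2 ^ t * n ^ suc (suc t)                   ≤⟨ *-monoˡ-≤ (n ^ suc (suc t)) (^-monoˡ-≤ t 2≤n) ⟩
    n ^ t * n ^ suc (suc t)                   ≡⟨ ^-distribˡ-+-* n t (suc (suc t)) ⟨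
    n ^ (t + suc (suc t))                     ≤⟨ ^-monoʳ-≤ n (subst (_≤ L) (ring₂ t) 2h≤L) ⟩
    n ^ L                                     ∎
    where
      open ≤-Reasoning
      4D+4≤t : 2 * (2 * D) + 4 ≤ t
      4D+4≤t = s≤s⁻¹ (subst (_≤ suc t) (ring₃ D) 4D+5≤h)
        where
          ring₃ : ∀ D → 4 * D + 5 ≡ suc (2 * (2 * D) + 4)
          ring₃ = solve-∀
      ring₁ : ∀ D t y → D * (2 * (suc (suc t) * y)) ≡ (2 * D) * (t + 2) * y
      ring₁ = solve-∀
      ring₂ : ∀ t → 2 * suc t ≡ t + suc (suc t)
      ring₂ = solve-∀

  cube<power : ∀ n D L → 2 ≤ n → 2 * D + 7 ≤ L → D * n ^ 3 < n ^ L
  cube<power n D L 2≤n@(s≤s (s≤s _)) 2D+7≤L with m≤n⇒∃[o]m+o≡n (≤-trans (m≤n+m 3 (2 * D + 4)) (subst (_≤ L) (ring D) 2D+7≤L))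
    where
      ring : ∀ D → 2 * D + 7 ≡ 2 * D + 4 + 3
      ring = solve-∀
  ... | t , refl = begin-strict
    D * n ^ 3           ≡⟨ *-comm D (n ^ 3) ⟩
    n ^ 3 * D           <⟨ *-monoʳ-< (n ^ 3) ⦃ m^n≢0 n 3 ⦄ D<n^t ⟩
    n ^ 3 * n ^ t       ≡⟨ ^-distribˡ-+-* n 3 t ⟨
    n ^ (3 + t)         ∎
    where
      open ≤-Reasoning
      2D+4≤t : 2 * D + 4 ≤ t
      2D+4≤t = +-cancelˡ-≤ 3 (2 * D + 4) t (subst (_≤ 3 + t) (ring D) 2D+7≤L)
        where
          ring : ∀ D → 2 * D + 7 ≡ 3 + (2 * D + 4)
          ring = solve-∀
      D<n^t : D < n ^ t
      D<n^t = begin-strict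
        D            ≤⟨ subst (λ z → D ≤ D * z) (+-comm 2 t) (m≤m*n D (2 + t)) ⟩
        D * (t + 2)  <⟨ linear<2^ D t 2D+4≤t ⟩
        2 ^ t        ≤⟨ ^-monoˡ-≤ t 2≤n ⟩
        n ^ t        ∎

module RationalBounds where

  open import Data.Empty using (⊥-elim)
  open import Data.Integer as ℤ using (+_; +[1+_]; -[1+_]; _⊖_)
  import Data.Integer.Properties as ℤ
  open import Data.Nat as ℕ using (ℕ; suc; z≤n; s≤s)
  import Data.Nat.Properties as ℕ
  open import Data.Product using (_,_)
  open import Data.Rational
  open import Data.Rational.Properties
  open import Data.Rational.Unnormalised as ℚᵘ using (mkℚᵘ; *≡*; *<*) renaming (_≃_ to _≃ᵘ_)
  import Data.Rational.Unnormalised.Properties as ℚᵘ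
  open import Data.Sum using (inj₁; inj₂)
  open import Relation.Binary.PropositionalEquality
  open import Relation.Nullary using (yes; no)
  open import Defs using (ratio; rhs; invPow)

  ∣⊖∣≡∣-∣ : ∀ m n → ℤ.∣ m ⊖ n ∣ ≡ ℕ.∣ m - n ∣
  ∣⊖∣≡∣-∣ m n with ℕ.≤-total m n
  ... | inj₁ m≤n = trans (ℤ.∣⊖∣-≤ m≤n) (sym (ℕ.m≤n⇒∣m-n∣≡n∸m m≤n))
  ... | inj₂ n≤m = trans (ℤ.∣m⊖n∣≡∣n⊖m∣ m n) (trans (ℤ.∣⊖∣-≤ n≤m) (sym (ℕ.m≤n⇒∣n-m∣≡n∸m n≤m)))

  ratio-inverse : ∀ N r → 0ℚ < r → ratio N r * r ≡ (+ N) / 1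
  ratio-inverse N r 0<r with r ≟ 0ℚ
  ... | yes r≡0 = ⊥-elim (<-irrefl (sym r≡0) 0<r)
  ... | no  r≢0 = begin
    ((+ N) / 1 * 1/ r) * r ≡⟨ *-assoc ((+ N) / 1) (1/ r) r ⟩
    (+ N) / 1 * (1/ r * r) ≡⟨ cong ((+ N) / 1 *_) (*-inverseˡ r) ⟩
    (+ N) / 1 * 1ℚ         ≡⟨ *-identityʳ _ ⟩
    (+ N) / 1              ∎
    where
      open ≡-Reasoning
      instance _ = ≢-nonZero r≢0

  ratio≃ : ∀ N R → toℚᵘ (ratio N ((+ suc R) / 1)) ≃ᵘ mkℚᵘ (+ N) R
  ratio≃ N R with ratio N ((+ suc R) / 1) | ratio-inverse N ((+ suc R) / 1) 0<R
    where
      0<R : 0ℚ < (+ suc R) / 1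
      0<R = toℚᵘ-cancel-< (ℚᵘ.<-respʳ-≃ (ℚᵘ.≃-sym (toℚᵘ-fromℚᵘ (mkℚᵘ (+ suc R) 0))) (*<* (ℤ.+<+ (s≤s z≤n))))
  ... | x@(mkℚ z d _) | x*r≡N = *≡* (begin
    z ℤ.* + suc R                        ≡⟨ ℤ.*-identityʳ _ ⟨
    (z ℤ.* + suc R) ℤ.* + 1              ≡⟨ cross ⟩
    + N ℤ.* + suc (d ℕ.* 1)              ≡⟨ cong (λ k → + N ℤ.* + suc k) (ℕ.*-identityʳ d) ⟩
    + N ℤ.* + suc d                      ∎)
    where
      open ≡-Reasoning
      product : toℚᵘ x ℚᵘ.* mkℚᵘ (+ suc R) 0 ≃ᵘ mkℚᵘ (+ N) 0
      product = ℚᵘ.≃-trans (ℚᵘ.*-congˡ {toℚᵘ x} (ℚᵘ.≃-sym (toℚᵘ-fromℚᵘ (mkℚᵘ (+ suc R) 0))))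
                  (ℚᵘ.≃-trans (ℚᵘ.≃-sym (toℚᵘ-homo-* x ((+ suc R) / 1)))
                    (ℚᵘ.≃-trans (toℚᵘ-cong x*r≡N) (toℚᵘ-fromℚᵘ (mkℚᵘ (+ N) 0))))
      cross : (z ℤ.* + suc R) ℤ.* + 1 ≡ + N ℤ.* + suc (d ℕ.* 1)
      cross with product
      ... | *≡* eq = eq

  -- |N/(R+1) - 1| = |N - (R+1)| / (R+1), and ε ≥ 1 / ↧ε.
  near-one : ∀ (x : ℚ) N R (ε : ℚ) → 0ℚ < ε → toℚᵘ x ≃ᵘ mkℚᵘ (+ N) R →
             ℕ.∣ N - suc R ∣ ℕ.* ↧ₙ ε ℕ.< suc R → ∣ x - 1ℚ ∣ < ε
  near-one x N R ε@(mkℚ +[1+ e ] D _) _ x≃ bound =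
    toℚᵘ-cancel-< (ℚᵘ.<-respˡ-≃ (ℚᵘ.≃-sym ∣x-1∣≃)
      (*<* (subst₂ ℤ._<_ (ℤ.pos-* K (suc D)) (ℤ.pos-* (suc e) (suc (R ℕ.* 1))) cross)))
    where
      ∣x-1∣≃ : toℚᵘ ∣ x - 1ℚ ∣ ≃ᵘ ℚᵘ.∣ mkℚᵘ (+ N) R ℚᵘ.+ ℚᵘ.- mkℚᵘ (+ 1) 0 ∣
      ∣x-1∣≃ = ℚᵘ.≃-trans (toℚᵘ-homo-∣-∣ (x - 1ℚ))
                 (ℚᵘ.∣-∣-cong (ℚᵘ.≃-trans (toℚᵘ-homo-+ x (- 1ℚ)) (ℚᵘ.+-cong x≃ (toℚᵘ-homo‿- 1ℚ))))
      K : ℕ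
      K = ℤ.∣ + N ℤ.* + 1 ℤ.+ ℤ.- (+ 1) ℤ.* + suc R ∣
      K≡ : K ≡ ℕ.∣ N - suc R ∣
      K≡ = trans (cong ℤ.∣_∣ (trans (cong₂ ℤ._+_ (ℤ.*-identityʳ (+ N)) (ℤ.-1*i≡-i (+ suc R))) (ℤ.m-n≡m⊖n N (suc R))))
                 (∣⊖∣≡∣-∣ N (suc R))
      K*D<R : K ℕ.* suc D ℕ.< suc R
      K*D<R = subst (λ k → k ℕ.* suc D ℕ.< suc R) (sym K≡) bound
      cross : + (K ℕ.* suc D) ℤ.< + (suc e ℕ.* suc (R ℕ.* 1))
      cross = ℤ.+<+ (ℕ.<-≤-trans K*D<R (subst (suc R ℕ.≤_) (cong (λ z → suc e ℕ.* suc z) (sym (ℕ.*-identityʳ R)))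
                                          (ℕ.m≤n*m (suc R) (suc e))))
  near-one x N R (mkℚ (+ 0) D c) 0<ε _ _ with toℚᵘ-mono-< {0ℚ} {mkℚ (+ 0) D c} 0<ε
  ... | *<* (ℤ.+<+ ())
  near-one x N R (mkℚ -[1+ e ] D c) 0<ε _ _ with toℚᵘ-mono-< {0ℚ} {mkℚ -[1+ e ] D c} 0<ε
  ... | *<* ()

  ratio-near-one : ∀ N R (ε : ℚ) → 0ℚ < ε → 1 ℕ.≤ R → ℕ.∣ N - R ∣ ℕ.* ↧ₙ ε ℕ.< R →
                   ∣ ratio N ((+ R) / 1) - 1ℚ ∣ < ε
  ratio-near-one N (suc R) ε 0<ε _ = near-one _ N R ε 0<ε (ratio≃ N R)

  rhs≡ : ∀ n E g B → 1 ℕ.≤ n → n ℕ.^ E ≡ B ℕ.* n ℕ.^ (3 ℕ.* g) → rhs n E g ≡ (+ (n ℕ.^ E ℕ.+ B)) / 1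
  rhs≡ n@(suc _) E g B _ A≡ = toℚᵘ-injective (ℚᵘ.≃-trans
    (toℚᵘ-homo-* ((+ A) / 1) (invPow n (3 ℕ.* g) + 1ℚ))
    (ℚᵘ.≃-trans (ℚᵘ.*-cong (toℚᵘ-fromℚᵘ (mkℚᵘ (+ A) 0))
                           (ℚᵘ.≃-trans (toℚᵘ-homo-+ (invPow n (3 ℕ.* g)) 1ℚ) (ℚᵘ.+-cong inv≃ ℚᵘ.≃-refl)))
      (ℚᵘ.≃-trans (*≡* (integer-identity (A*[M+1]≡[A+B]*M))) (ℚᵘ.≃-sym (toℚᵘ-fromℚᵘ (mkℚᵘ (+ (A ℕ.+ B)) 0))))))
    where
      A : ℕ
      A = n ℕ.^ E
      M-1 : ℕ
      M-1 = ℕ.pred (n ℕ.^ (3 ℕ.* g))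
      M≡ : n ℕ.^ (3 ℕ.* g) ≡ suc M-1
      M≡ = sym (ℕ.suc-pred (n ℕ.^ (3 ℕ.* g)) ⦃ ℕ.m^n≢0 n (3 ℕ.* g) ⦄)
      inv≃ : toℚᵘ (invPow n (3 ℕ.* g)) ≃ᵘ mkℚᵘ (+ 1) M-1
      inv≃ = ℚᵘ.≃-trans (ℚᵘ.≃-reflexive (cong toℚᵘ (/-cong {+ 1} {n ℕ.^ (3 ℕ.* g)} {+ 1} {suc M-1} refl M≡)))
                        (toℚᵘ-fromℚᵘ (mkℚᵘ (+ 1) M-1))
        where instance _ = ℕ.m^n≢0 n (3 ℕ.* g)
      M : ℕ
      M = suc M-1
      A*[M+1]≡[A+B]*M : A ℕ.* suc M ≡ (A ℕ.+ B) ℕ.* M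
      A*[M+1]≡[A+B]*M = begin
        A ℕ.* suc M          ≡⟨ ℕ.*-suc A M ⟩
        A ℕ.+ A ℕ.* M        ≡⟨ ℕ.+-comm A (A ℕ.* M) ⟩
        A ℕ.* M ℕ.+ A        ≡⟨ cong (A ℕ.* M ℕ.+_) (trans A≡ (cong (B ℕ.*_) M≡)) ⟩
        A ℕ.* M ℕ.+ B ℕ.* M  ≡⟨ ℕ.*-distribʳ-+ M A B ⟨
        (A ℕ.+ B) ℕ.* M      ∎
        where open ≡-Reasoning
      integer-identity : A ℕ.* suc M ≡ (A ℕ.+ B) ℕ.* M →
                         (+ A ℤ.* (+ 1 ℤ.* + 1 ℤ.+ + 1 ℤ.* + M)) ℤ.* + 1 ≡ + (A ℕ.+ B) ℤ.* + suc (M-1 ℕ.* 1 ℕ.+ 0)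
      integer-identity eq = begin
        (+ A ℤ.* (+ 1 ℤ.* + 1 ℤ.+ + 1 ℤ.* + M)) ℤ.* + 1 ≡⟨ ℤ.*-identityʳ _ ⟩
        + A ℤ.* (+ 1 ℤ.+ + 1 ℤ.* + M)                    ≡⟨ cong (λ z → + A ℤ.* (+ 1 ℤ.+ z)) (ℤ.*-identityˡ (+ M)) ⟩
        + A ℤ.* + suc M                                   ≡⟨ ℤ.pos-* A (suc M) ⟨
        + (A ℕ.* suc M)                                   ≡⟨ cong +_ eq ⟩
        + ((A ℕ.+ B) ℕ.* M)                               ≡⟨ ℤ.pos-* (A ℕ.+ B) M ⟩
        + (A ℕ.+ B) ℤ.* + M
          ≡⟨ cong (λ k → + (A ℕ.+ B) ℤ.* + suc k) (trans (ℕ.+-identityʳ _) (ℕ.*-identityʳ M-1)) ⟨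
        + (A ℕ.+ B) ℤ.* + suc (M-1 ℕ.* 1 ℕ.+ 0)           ∎
        where open ≡-Reasoning

module Estimate where

  open import Data.Nat hiding (_/_)
  open import Data.Nat.Primality using (Prime)
  open import Data.Nat.Properties
  open import Data.Nat.Tactic.RingSolver using (solve-∀)
  import Data.Integer as ℤ
  open import Data.Rational using (_/_)
  open import Data.Sum using (inj₁; inj₂)
  open import Relation.Binary.PropositionalEquality
  open import Defs
  open Counting
  open Primes
  open Semiprimes
  open Growth
  open RationalBounds

  2*⌊/2⌋≤ : ∀ L → 2 * ⌊ L /2⌋ ≤ L
  2*⌊/2⌋≤ L = begin
    2 * ⌊ L /2⌋          ≡⟨ cong (⌊ L /2⌋ +_) (+-identityʳ ⌊ L /2⌋) ⟩
    ⌊ L /2⌋ + ⌊ L /2⌋    ≤⟨ +-monoʳ-≤ ⌊ L /2⌋ (⌊n/2⌋≤⌈n/2⌉ L) ⟩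
    ⌊ L /2⌋ + ⌈ L /2⌉    ≡⟨ ⌊n/2⌋+⌈n/2⌉≡n L ⟩
    L                    ∎
    where open ≤-Reasoning

  ≤2*⌊/2⌋+1 : ∀ L → L ≤ 2 * ⌊ L /2⌋ + 1
  ≤2*⌊/2⌋+1 L = begin
    L                         ≡⟨ ⌊n/2⌋+⌈n/2⌉≡n L ⟨
    ⌊ L /2⌋ + ⌈ L /2⌉         ≤⟨ +-monoʳ-≤ ⌊ L /2⌋ (⌊n/2⌋-mono (n≤1+n (suc L))) ⟩
    ⌊ L /2⌋ + suc ⌊ L /2⌋     ≡⟨ ring ⌊ L /2⌋ ⟩
    2 * ⌊ L /2⌋ + 1           ∎
    where
      open ≤-Reasoning
      ring : ∀ h → h + suc h ≡ 2 * h + 1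
      ring = solve-∀

  ∣-∣*<  : ∀ {m n a b D c} → m ≤ n + a → n ≤ m + b → a * D < c → b * D < c → ∣ m - n ∣ * D < c
  ∣-∣*< {m} {n} {a} {b} {D} m≤n+a n≤m+b aD<c bD<c with ≤-total m n
  ... | inj₁ m≤n = ≤-<-trans (*-monoˡ-≤ D (subst (_≤ b) (sym (m≤n⇒∣m-n∣≡n∸m m≤n)) (m≤n+o⇒m∸n≤o n m n≤m+b))) bD<c
  ... | inj₂ n≤m = ≤-<-trans (*-monoˡ-≤ D (subst (_≤ a) (sym (m≤n⇒∣n-m∣≡n∸m n≤m)) (m≤n+o⇒m∸n≤o m n m≤n+a))) aD<c

  ≤⌊3*/2⌋ : ∀ m → m ≤ ⌊ 3 * m /2⌋
  ≤⌊3*/2⌋ m = s≤s⁻¹ (*-cancelˡ-< 2 m (suc h) (begin-strict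
    2 * m      ≤⟨ *-monoˡ-≤ m (n≤1+n 2) ⟩
    3 * m      ≤⟨ ≤2*⌊/2⌋+1 (3 * m) ⟩
    2 * h + 1  <⟨ ≤-reflexive (ring h) ⟩
    2 * suc h  ∎))
    where
      open ≤-Reasoning
      h : ℕ
      h = ⌊ 3 * m /2⌋
      ring : ∀ h → suc (2 * h + 1) ≡ 2 * suc h
      ring = solve-∀

  module _ (n : ℕ) (2≤n : 2 ≤ n) {p P : ℕ} (primep : Prime p) (primeP : Prime P) (8≤p : 8 ≤ p) (p<P : p < P) where

    open SemiprimeCount n primep primeP 8≤p p<P
    open Enumeration n using (length-primitiveWords≤; length-primitiveWords≥)

    private
      h : ℕ
      h = ⌊ 3 * P /2⌋

      -- Bounds the number of nonprimitive words of each length L ≤ 3P.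
      E : ℕ
      E = suc h * n ^ suc h

    ε₂-semiprime≤ : π (3 * P) + (π (3 * p) + π 3) ≤ n ^ (3 * P) + n ^ (3 * p) + n ^ 3
    ε₂-semiprime≤ = subst (π (3 * P) + (π (3 * p) + π 3) ≤_) (sym (+-assoc (n ^ (3 * P)) _ _))
      (+-mono-≤ (length-primitiveWords≤ (3 * P)) (+-mono-≤ (length-primitiveWords≤ (3 * p)) (length-primitiveWords≤ 3)))

    ε₂-semiprime≥ : n ^ (3 * P) + n ^ (3 * p) ≤ π (3 * P) + (π (3 * p) + π 3) + 2 * E
    ε₂-semiprime≥ = begin
      n ^ (3 * P) + n ^ (3 * p)               ≤⟨ +-mono-≤ (primitive≥ P p≤P ≤-refl) (primitive≥ p ≤-refl p≤P) ⟩
      π (3 * P) + E + (π (3 * p) + E)         ≡⟨ ring (π (3 * P)) (π (3 * p)) E ⟩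
      π (3 * P) + π (3 * p) + 2 * E           ≤⟨ +-monoˡ-≤ (2 * E) (+-monoʳ-≤ (π (3 * P)) (m≤m+n (π (3 * p)) (π 3))) ⟩
      π (3 * P) + (π (3 * p) + π 3) + 2 * E   ∎
      where
        open ≤-Reasoning
        ring : ∀ a b E → a + E + (b + E) ≡ a + b + 2 * E
        ring = solve-∀
        primitive≥ : ∀ q → p ≤ q → q ≤ P → n ^ (3 * q) ≤ π (3 * q) + E
        primitive≥ q p≤q q≤P = length-primitiveWords≥ (≤-trans (s≤s z≤n) 2≤n) (3 * q) h
          (≤-trans (≤-trans 1≤p p≤q) (m≤m+n q _)) (≤-trans (*-monoʳ-≤ 3 q≤P) (≤2*⌊/2⌋+1 (3 * P)))

    ε₂-semiprime-close : ∀ D → 4 * D + 5 ≤ P →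
                         ∣ π (3 * P) + (π (3 * p) + π 3) - (n ^ (3 * P) + n ^ (3 * p)) ∣ * D < n ^ (3 * P) + n ^ (3 * p)
    ε₂-semiprime-close D 4D+5≤P = ∣-∣*< ε₂-semiprime≤ ε₂-semiprime≥
      (<-≤-trans (subst (_< n ^ (3 * P)) (*-comm D _) cube) (m≤m+n _ _))
      (<-≤-trans (subst (_< n ^ (3 * P)) (*-comm D _) error) (m≤m+n _ _))
      where
        cube : D * n ^ 3 < n ^ (3 * P)
        cube = cube<power n D (3 * P) 2≤n (≤-trans (subst (2 * D + 7 ≤_) (ring D) (m≤m+n (2 * D + 7) (10 * D + 8)))
                                                    (*-monoʳ-≤ 3 4D+5≤P))
          where
            ring : ∀ D → 2 * D + 7 + (10 * D + 8) ≡ 3 * (4 * D + 5)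
            ring = solve-∀
        error : D * (2 * E) < n ^ (3 * P)
        error = error<power n D h (3 * P) 2≤n (≤-trans 4D+5≤P (≤⌊3*/2⌋ P)) (2*⌊/2⌋≤ (3 * P))

  exponent-semiprime : ∀ {p P e} → 1 ≤ p → e * p ≡ 3 * (p * P) → e ≡ 3 * P
  exponent-semiprime {suc p} {P} {e} _ e*p≡ = *-cancelʳ-≡ e (3 * P) (suc p) (trans e*p≡ (ring (suc p) P))
    where
      ring : ∀ p P → 3 * (p * P) ≡ 3 * P * p
      ring = solve-∀

  ^-3*-split : ∀ n {p P} → p ≤ P → n ^ (3 * P) ≡ n ^ (3 * p) * n ^ (3 * (P ∸ p))
  ^-3*-split n {p} {P} p≤P = begin
    n ^ (3 * P)                        ≡⟨ cong (λ x → n ^ (3 * x)) (m+[n∸m]≡n p≤P) ⟨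
    n ^ (3 * (p + (P ∸ p)))            ≡⟨ cong (n ^_) (*-distribˡ-+ 3 p (P ∸ p)) ⟩
    n ^ (3 * p + 3 * (P ∸ p))          ≡⟨ ^-distribˡ-+-* n (3 * p) (3 * (P ∸ p)) ⟩
    n ^ (3 * p) * n ^ (3 * (P ∸ p))    ∎
    where open ≡-Reasoning

  rhs-semiprime : ∀ n {p P d e} → 1 ≤ n → Prime p → Prime P → p < P → 4 ≤ p →
                  IsDelta (p * P) d → e * d ≡ 3 * (p * P) →
                  rhs n e (P ∸ p) ≡ (ℤ.+ (n ^ (3 * P) + n ^ (3 * p))) / 1
  rhs-semiprime n {p} {P} {e = e} 1≤n primep primeP p<P 4≤p δ e*d≡ =
    trans (cong (λ x → rhs n x (P ∸ p)) e≡3P) (rhs≡ n (3 * P) (P ∸ p) (n ^ (3 * p)) 1≤n (^-3*-split n (<⇒≤ p<P)))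
    where
      e≡3P : e ≡ 3 * P
      e≡3P = exponent-semiprime (≤-trans (s≤s z≤n) 4≤p)
               (subst (λ x → e * x ≡ 3 * (p * P)) (δ-semiprime primep primeP p<P 4≤p δ) e*d≡)

open import Defs
open import Data.Nat using (ℕ; suc; _*_; _∸_; _≤_)
open import Data.Rational using (ℚ; 0ℚ; 1ℚ; _-_; ∣_∣; _<_)
open import Data.Product using (∃; ∃-syntax; _×_)
open import Relation.Binary.PropositionalEquality using (_≡_)
open import Data.Nat using (_+_; s≤s; z≤n)
open import Data.Nat.Properties using (≤-trans; m≤n+m; m≤m+n; m^n>0)
open import Data.Product using (_,_)
open import Data.Rational using (↧ₙ_)
open import Relation.Binary.PropositionalEquality using (subst; sym)
open Primes using (nthPrime≥8; nthPrime-<; index≤nthPrime)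
open Semiprimes using (module SemiprimeCount)
open RationalBounds using (ratio-near-one)
open Estimate using (ε₂-semiprime-close; rhs-semiprime)

proposition4p6 : (n : ℕ) → 2 ≤ n → (ε : ℚ) → 0ℚ < ε →
    ∃[ K ] ((k pk pk₁ d e : ℕ) → K ≤ k →
      IsNthPrime k pk → IsNthPrime (suc k) pk₁ →
      IsDelta (pk * pk₁) d → e * d ≡ 3 * (pk * pk₁) →
      ∃[ N ] (Eps2 n (pk * pk₁) N ×
        ∣ ratio N (rhs n e (pk₁ ∸ pk)) - 1ℚ ∣ < ε))
proposition4p6 n 2≤n@(s≤s (s≤s _)) ε 0<ε = 4 * ↧ₙ ε + 5 , estimate
  where
    estimate : (k p P d e : ℕ) → 4 * ↧ₙ ε + 5 ≤ k → IsNthPrime k p → IsNthPrime (suc k) P →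
               IsDelta (p * P) d → e * d ≡ 3 * (p * P) →
               ∃[ N ] (Eps2 n (p * P) N × ∣ ratio N (rhs n e (P ∸ p)) - 1ℚ ∣ < ε)
    estimate k p P d e K≤k pₖ@(primep , _) pₖ₊₁@(primeP , _) δ e*d≡ =
      N , ε₂-semiprime ,
      subst (λ r → ∣ ratio N r - 1ℚ ∣ < ε) (sym (rhs-semiprime n {e = e} (s≤s z≤n) primep primeP p<P 4≤p δ e*d≡))
        (ratio-near-one N _ ε 0<ε (≤-trans (m^n>0 n (3 * P)) (m≤m+n _ _))
          (ε₂-semiprime-close n 2≤n primep primeP 8≤p p<P (↧ₙ ε) (≤-trans K≤k (index≤nthPrime pₖ₊₁))))
      where
        8≤p : 8 ≤ p
        8≤p = nthPrime≥8 (≤-trans (m≤n+m 5 (4 * ↧ₙ ε)) K≤k) pₖ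
        4≤p : 4 ≤ p
        4≤p = ≤-trans (m≤m+n 4 4) 8≤p
        p<P : p Data.Nat.< P
        p<P = nthPrime-< pₖ pₖ₊₁
        open SemiprimeCount n primep primeP 8≤p p<P using (ε₂-semiprime; π)
        N : ℕ
        N = π (3 * P) + (π (3 * p) + π 3)
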